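{- Let $\Upsilon$ be a hyperfrustrated gain signed graph (i.e. $E$ is hyperfrustrated). Then every maximal hyperbalanced edge set $A\subseteq E$ is a coatom of the lattice of flats of $M(\Upsilon)$, with $b_\Sigma(A)=b_\Sigma(E)$ and $\mathrm{rk}_\Upsilon(A)=\mathrm{rk}_\Upsilon(E)-1=n-b_\Sigma(E)$.
   Context: Let $\mathbb{K}$ be a field of characteristic $\ne2$. A graph $\Gamma=(V,E)$ has vertex set $V=\{v_1,\dots,v_n\}$ and finite edge set $E$; edges are links (two ends at distinct vertices), loops (two ends at one vertex), half edges (one end) or loose edges (no ends); parallel edges allowed. A gain signed graph $\Upsilon=(\Gamma,\sigma,\varphi)$: $\sigma:E\to\{\pm1\}$ (half edges negative, loose edges positive); with an orientation $\tau$ (signs $\tau(v,e)\in\{\pm1\}$ on edge ends, $\tau(v,e)\tau(w,e)=-\sigma(e)$ for a link or loop with ends $v,w$) each edge has gain $\varphi(e)\in\mathbb{K}$, negated on reorientation. Neutral = gain $0$. Walk gain of $W=u_0e_1\cdots e_lu_l$: $\varphi(W)=-\sum_i\varphi(e_i)\sigma(W_{0,i-1})\tau(u_{i-1},e_i)$, $\sigma(W_{0,j})=\prod_{i\le j}\sigma(e_i)$. Ultrawalks may begin with a half edge $e_0$ at $u_0$ and/or end with a half edge $e_{l+1}$ at $u_l$; their gain adds $\tau(u_0,e_0)\varphi(e_0)$ and/or $-\varphi(e_{l+1})\sigma(W_{0,l})\tau(u_l,e_{l+1})$ to $\varphi(W_{0,l})$. Circles: connected 2-regular subgraphs, sign =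 product of edge signs; a negative figure is a negative circle or a half edge. A sign circuit is a positive circle, a loose edge, or a handcuff (two negative figures with exactly one common vertex, or two disjoint negative figures plus a path joining them meeting them only at its ends). Its gain: the edge gain for a loose edge; else $\varphi(W)$ for a circuit walk (once around a positive circle; for a handcuff with figures $C_1,C_2$, connecting path $P$ of length $\ge0$: around $C_1$, along $P$, around $C_2$, back along $P$ if both circles; from half edge $C_1$ along $P$, around $C_2$, back, ending with $C_1$ if $C_1$ half edge and $C_2$ circle; from one half edge along $P$ to the other if both half edges); well defined up to sign; neutral if $0$. $S$ is hyperbalanced if all sign circuits in $S$ are neutral, hyperfrustrated otherwise; sign balanced if it has no negative circle and no half edge. Components: connected components of $(V,S)$ (loose edges excluded, isolated vertices included); $b_\Sigma(S)$ = number of sign-balanced components. $M(\Upsilon)$: matroid on $E$ with rank $\mathrm{rk}_\Upsilon(S)=n-b_\Sigma(S)+\delta(S)$, $\delta(S)=0$ if $S$ hyperbalanced and $1$ otherwise. A coatom is a flat of rank $\mathrm{rk}_\Upsilon(E)-1$. -}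

module Defs where

open import Level using (Level; _⊔_) renaming (suc to lsuc)
open import Data.Nat using (ℕ; suc; _∸_; _<_; _≤_)
open import Data.Fin using (Fin; toℕ)
open import Data.Fin.Subset using (Subset; _∈_; _∉_; _⊂_; _∪_; ⁅_⁆; ⊤)
open import Data.Sign using (Sign; opposite) renaming (_*_ to _*ₛ_; + to pos; - to neg)
open import Data.List using (List; []; _∷_; _++_)
open import Data.List.Relation.Unary.Unique.Propositional using (Unique)
open import Data.List.Relation.Unary.All using (All)
open import Data.List.Membership.Propositional using () renaming (_∈_ to _∈ₗ_)
open import Data.Product using (Σ; ∃; _×_; _,_)
open import Data.Sum using (_⊎_)
open import Data.Empty using (⊥)
open import Relation.Binary.PropositionalEquality using (_≡_; _≢_)
open import Relation.Nullary using (¬_)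
open import Algebra.Bundles using (CommutativeRing)

record Field (c ℓ : Level) : Set (lsuc (c ⊔ ℓ)) where
  field
    commutativeRing : CommutativeRing c ℓ
  open CommutativeRing commutativeRing public
  field
    1≉0     : ¬ (1# ≈ 0#)
    inverse : ∀ x → ¬ (x ≈ 0#) → ∃ λ y → (x * y) ≈ 1#

CharNot2 : ∀ {c ℓ} → Field c ℓ → Set ℓ
CharNot2 K = ¬ ((1# + 1#) ≈ 0#) where open Field K

-- Edges.  'edge2 v w' is an edge with two ends, at v (end 0) and w (end 1):
-- a link if v ≢ w, a loop if v ≡ w.  'half v' is a half edge at v,
-- 'loose' a loose edge.

data EdgeKind (n : ℕ) : Set where
  edge2 : Fin n → Fin n → EdgeKind n
  half  : Fin n → EdgeKind n
  loose : EdgeKind n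

-- A gain signed graph with vertices Fin n and edges Fin m, together with a
-- fixed orientation τ (τ₀ e = sign of end 0, τ₁ e = sign of end 1; for a
-- half edge only τ₀ is used) and the gains φ relative to that orientation.
record GSG {c ℓ : Level} (K : Field c ℓ) (n m : ℕ) : Set c where
  open Field K using (Carrier)
  field
    kind      : Fin m → EdgeKind n
    σ         : Fin m → Sign
    τ₀ τ₁     : Fin m → Sign
    φ         : Fin m → Carrier
    half-neg  : ∀ e v → kind e ≡ half v → σ e ≡ neg
    loose-pos : ∀ e → kind e ≡ loose → σ e ≡ pos
    orient    : ∀ e v w → kind e ≡ edge2 v w → (τ₀ e *ₛ τ₁ e) ≡ opposite (σ e)

module _ {c ℓ : Level} {K : Field c ℓ} {n m : ℕ} (G : GSG K n m) where
  open Field K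
  open GSG G

  sgn : Sign → Carrier → Carrier
  sgn pos x = x
  sgn neg x = - x

  data Step (u v : Fin n) : Set where
    fwd : (e : Fin m) → kind e ≡ edge2 u v → Step u v
    bwd : (e : Fin m) → kind e ≡ edge2 v u → Step u v

  stepEdge : ∀ {u v} → Step u v → Fin m
  stepEdge (fwd e _) = e
  stepEdge (bwd e _) = e

  stepτ : ∀ {u v} → Step u v → Sign
  stepτ (fwd e _) = τ₀ e
  stepτ (bwd e _) = τ₁ e

  flipStep : ∀ {u v} → Step u v → Step v u
  flipStep (fwd e p) = bwd e p
  flipStep (bwd e p) = fwd e p

  infixr 5 _∷_ _++W_
  data Walk : Fin n → Fin n → Set where
    []  : ∀ {u} → Walk u u
    _∷_ : ∀ {u v w} → Step u v → Walk v w → Walk u w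

  _++W_ : ∀ {u v w} → Walk u v → Walk v w → Walk u w
  [] ++W W = W
  (s ∷ V) ++W W = s ∷ (V ++W W)

  revW : ∀ {u v} → Walk u v → Walk v u
  revW [] = []
  revW (s ∷ W) = revW W ++W (flipStep s ∷ [])

  edgesW : ∀ {u v} → Walk u v → List (Fin m)
  edgesW [] = []
  edgesW (s ∷ W) = stepEdge s ∷ edgesW W

  verts : ∀ {u v} → Walk u v → List (Fin n)
  verts {u} [] = u ∷ []
  verts {u} (s ∷ W) = u ∷ verts W

  initVerts : ∀ {u v} → Walk u v → List (Fin n)
  initVerts [] = []
  initVerts {u} (s ∷ W) = u ∷ initVerts W

  walkSign : ∀ {u v} → Walk u v → Sign
  walkSign [] = pos
  walkSign (s ∷ W) = σ (stepEdge s) *ₛ walkSign W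

  -- Σ_i φ(e_i) σ(W_{0,i-1}) τ(u_{i-1},e_i), with the running sign as accumulator
  gainAcc : ∀ {u v} → Sign → Walk u v → Carrier
  gainAcc s [] = 0#
  gainAcc s (st ∷ W) = sgn (s *ₛ stepτ st) (φ (stepEdge st)) + gainAcc (s *ₛ σ (stepEdge st)) W

  walkGain : ∀ {u v} → Walk u v → Carrier
  walkGain W = - gainAcc pos W

  -- gain of the ultrawalk  h₀ W h₁  (h₀ half edge at start, h₁ at end)
  ultraGain : ∀ {u v} → Fin m → Walk u v → Fin m → Carrier
  ultraGain h₀ W h₁ = (sgn (τ₀ h₀) (φ h₀) + walkGain W) + - sgn (walkSign W *ₛ τ₀ h₁) (φ h₁)

  IsCircle : ∀ {u} → Walk u u → Set
  IsCircle [] = ⊥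
  IsCircle C@(_ ∷ _) = Unique (initVerts C) × Unique (edgesW C)

  IsPath : ∀ {u v} → Walk u v → Set
  IsPath P = Unique (verts P)

  data SignCircuit : Set where
    looseE    : (e : Fin m) → kind e ≡ loose → SignCircuit
    posCircle : ∀ {u} (C : Walk u u) → IsCircle C → walkSign C ≡ pos → SignCircuit
    -- handcuff of two negative circles C₁ (at u), C₂ (at w) joined by P
    hcCC : ∀ {u w} (C₁ : Walk u u) (P : Walk u w) (C₂ : Walk w w) →
           IsCircle C₁ → IsCircle C₂ → IsPath P →
           walkSign C₁ ≡ neg → walkSign C₂ ≡ neg →
           Unique (edgesW C₁ ++ edgesW P ++ edgesW C₂) →
           (∀ x → x ∈ₗ initVerts C₁ → x ∈ₗ verts P → x ≡ u) →
           (∀ x → x ∈ₗ initVerts C₂ → x ∈ₗ verts P → x ≡ w) →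
           (∀ x → x ∈ₗ initVerts C₁ → x ∈ₗ initVerts C₂ → x ∈ₗ verts P) →
           SignCircuit
    -- handcuff of a half edge h (at u) and a negative circle C₂ (at w) joined by P
    hcHC : ∀ {u w} (h : Fin m) → kind h ≡ half u → (P : Walk u w) (C₂ : Walk w w) →
           IsPath P → IsCircle C₂ → walkSign C₂ ≡ neg →
           Unique (edgesW P ++ edgesW C₂) →
           (∀ x → x ∈ₗ initVerts C₂ → x ∈ₗ verts P → x ≡ w) →
           SignCircuit
    -- handcuff of two distinct half edges h₁ (at u), h₂ (at w) joined by P
    hcHH : ∀ {u w} (h₁ h₂ : Fin m) → kind h₁ ≡ half u → kind h₂ ≡ half w → h₁ ≢ h₂ →
           (P : Walk u w) → IsPath P → SignCircuit

  circEdges : SignCircuit → List (Fin m)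
  circEdges (looseE e _) = e ∷ []
  circEdges (posCircle C _ _) = edgesW C
  circEdges (hcCC C₁ P C₂ _ _ _ _ _ _ _ _ _) = edgesW C₁ ++ edgesW P ++ edgesW C₂
  circEdges (hcHC h _ P C₂ _ _ _ _ _) = h ∷ edgesW P ++ edgesW C₂
  circEdges (hcHH h₁ h₂ _ _ _ P _) = h₁ ∷ h₂ ∷ edgesW P

  circGain : SignCircuit → Carrier
  circGain (looseE e _) = φ e
  circGain (posCircle C _ _) = walkGain C
  circGain (hcCC C₁ P C₂ _ _ _ _ _ _ _ _ _) = walkGain (C₁ ++W P ++W C₂ ++W revW P)
  circGain (hcHC h _ P C₂ _ _ _ _ _) = ultraGain h (P ++W C₂ ++W revW P) h
  circGain (hcHH h₁ h₂ _ _ _ P _) = ultraGain h₁ P h₂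

  Hyperbalanced : Subset m → Set ℓ
  Hyperbalanced S = (C : SignCircuit) → All (_∈ S) (circEdges C) → circGain C ≈ 0#

  MaximalHyperbalanced : Subset m → Set ℓ
  MaximalHyperbalanced A = Hyperbalanced A × (∀ B → A ⊂ B → ¬ Hyperbalanced B)

  Conn : Subset m → Fin n → Fin n → Set
  Conn S v w = Σ (Walk v w) λ W → All (_∈ S) (edgesW W)

  BalancedAt : Subset m → Fin n → Set
  BalancedAt S v =
    (∀ u h → kind h ≡ half u → h ∈ S → Conn S v u → ⊥) ×
    (∀ u (C : Walk u u) → IsCircle C → walkSign C ≡ neg → All (_∈ S) (edgesW C) → Conn S v u → ⊥)

  -- bΣ(S) ≡ b : the components of (V,S) can be enumerated by Fin k (labelling c)
  -- so that exactly the labels < b are the sign-balanced components.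
  BΣ : Subset m → ℕ → Set
  BΣ S b = Σ ℕ λ k → Σ (Fin n → Fin k) λ c →
    (∀ i → ∃ λ v → c v ≡ i) ×
    (∀ v w → (c v ≡ c w → Conn S v w) × (Conn S v w → c v ≡ c w)) ×
    (∀ v → (toℕ (c v) < b → BalancedAt S v) × (BalancedAt S v → toℕ (c v) < b)) ×
    b ≤ k

  -- rk_Υ(S) ≡ r, with rk = n - bΣ + δ
  Rank : Subset m → ℕ → Set ℓ
  Rank S r = Σ ℕ λ b → BΣ S b ×
    ((Hyperbalanced S × r ≡ n ∸ b) ⊎ (¬ Hyperbalanced S × r ≡ suc (n ∸ b)))

  IsFlat : Subset m → Set ℓ
  IsFlat S = ∀ e → e ∉ S → ∀ r r' → Rank S r → Rank (S ∪ ⁅ e ⁆) r' → r < r'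

  -- coatom of the lattice of flats: a flat of rank rk(E) - 1
  IsCoatom : Subset m → Set ℓ
  IsCoatom S = IsFlat S × (Σ ℕ λ r → Rank ⊤ (suc r) × Rank S r)

{-# OPTIONS --safe #-}
-- Let B be a sign-balanced component of a maximal hyperbalanced set A, with a
-- switching function ζ making every edge of A inside B consistent.  Take an
-- edge e ∉ A meeting B.  By maximality A ∪ {e} contains a non-neutral sign
-- circuit, necessarily through e.  But if e were a half edge at B, a link
-- leaving B, or a ζ-inconsistent edge inside B, then every walk in A ∪ {e}
-- using e once would end in B, and closed ones would be negative; so any sign
-- circuit through e would have a negative figure (or half edge) in A meeting
-- B, which is impossible.  Hence every edge meeting B stays inside B and is
-- ζ-consistent: B is also a sign-balanced component of E.  So
-- bΣ(A) = bΣ(E), and rk(A) = n - bΣ(E) = rk(E) - 1.  A is a flat because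
-- adding an edge makes it hyperfrustrated while bΣ cannot increase.
module Submission where

open import Defs
open import Level using (Level)
open import Data.Nat using (ℕ; suc; _∸_)
open import Data.Fin.Subset using (Subset; ⊤)
open import Data.Product using (Σ; _×_)
open import Relation.Nullary using (¬_)

open import Function using (_∘_; id)
open import Function.Bundles using (module Equivalence)
open import Data.Unit using (tt) renaming (⊤ to Unit)
open import Data.Empty using (⊥; ⊥-elim)
open import Data.Product using (∃; _,_; proj₁; proj₂)
open import Data.Sum using (_⊎_; inj₁; inj₂; [_,_]; swap)
open import Data.Nat using (zero; _+_; _<_; _≤_; z≤n; s≤s)
import Data.Nat.Properties as ℕₚ
open import Data.Fin using (Fin; zero; suc; toℕ; fromℕ; fromℕ<; inject₁; inject≤; lower₁)
import Data.Fin.Properties as Finₚ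
open import Data.Fin.Subset using (_∈_; _∉_; _⊆_; _⊂_; _∪_; ⁅_⁆)
open import Data.Fin.Subset.Properties using (_∈?_; ∈⊤; p⊆p∪q; x∈p∪q⁻; x∈p∪q⁺; x∈⁅y⁆⇒x≡y; x∈⁅x⁆)
open import Data.Bool using (Bool; true; false; T; _∧_)
open import Data.Bool.Properties using (T-∧)
open import Data.Sign using (Sign) renaming (_*_ to _*ₛ_; + to pos; - to neg)
import Data.Sign.Properties as Signₚ
open import Algebra.Properties.CommutativeSemigroup Signₚ.*-commutativeSemigroup using (x∙yz≈y∙xz)
open import Data.List using (List; []; _∷_; _++_; length; allFin)
open import Data.List.Properties using (length-++)
open import Data.List.Relation.Unary.All as All using (All; []; _∷_)
open import Data.List.Relation.Unary.All.Properties using (¬Any⇒All¬) renaming (++⁺ to All-++⁺; ++⁻ to All-++⁻)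
open import Data.List.Relation.Unary.Any using (here; there)
open import Data.List.Relation.Unary.AllPairs using ([]; _∷_)
open import Data.List.Relation.Unary.Unique.Propositional using (Unique)
open import Data.List.Relation.Binary.Disjoint.Propositional using (Disjoint)
open import Data.List.Membership.Propositional using () renaming (_∈_ to _∈ₗ_; _∉_ to _∉ₗ_)
open import Data.List.Membership.Propositional.Properties using (∈-++⁺ˡ; ∈-++⁺ʳ; ∈-++⁻; ∈-allFin)
import Data.List.Membership.DecPropositional as DecMembership
open import Data.Vec.Functional using (updateAt)
open import Data.Vec.Functional.Properties using (updateAt-updates; updateAt-minimal)
open import Relation.Binary.PropositionalEquality
  using (_≡_; _≢_; refl; sym; trans; cong; cong₂; subst; module ≡-Reasoning)
open import Relation.Nullary using (Dec; yes; no; contradiction)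
open import Relation.Nullary.Decidable using (T?)

open ≡-Reasoning
open Equivalence using (to; from)

pos≢neg : pos ≢ neg
pos≢neg ()

neg-factor : ∀ a b → a *ₛ b ≡ neg → a ≡ neg ⊎ b ≡ neg
neg-factor pos _ ab≡neg = inj₂ ab≡neg
neg-factor neg _ _      = inj₁ refl

≢⇒*ₛ≡neg : ∀ {a b} → a ≢ b → a *ₛ b ≡ neg
≢⇒*ₛ≡neg {pos} {pos} a≢b = contradiction refl a≢b
≢⇒*ₛ≡neg {pos} {neg} _   = refl
≢⇒*ₛ≡neg {neg} {pos} _   = refl
≢⇒*ₛ≡neg {neg} {neg} a≢b = contradiction refl a≢b

s*[s*t]≡t : ∀ s t → s *ₛ (s *ₛ t) ≡ t
s*[s*t]≡t s t = trans (sym (Signₚ.*-assoc s s t)) (cong (_*ₛ t) (Signₚ.s*s≡+ s))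

[a*b]*[b*c]≡a*c : ∀ a b c → (a *ₛ b) *ₛ (b *ₛ c) ≡ a *ₛ c
[a*b]*[b*c]≡a*c a b c = trans (Signₚ.*-assoc a b (b *ₛ c)) (cong (a *ₛ_) (s*[s*t]≡t b c))

[a*s]*[b*s]≡a*b : ∀ a b s → (a *ₛ s) *ₛ (b *ₛ s) ≡ a *ₛ b
[a*s]*[b*s]≡a*b a b s = trans (cong ((a *ₛ s) *ₛ_) (Signₚ.*-comm b s)) ([a*b]*[b*c]≡a*c a s b)

[x*a]*[s*[b*x]]≡s*[a*b] : ∀ x a s b → (x *ₛ a) *ₛ (s *ₛ (b *ₛ x)) ≡ s *ₛ (a *ₛ b)
[x*a]*[s*[b*x]]≡s*[a*b] x a s b = begin
  (x *ₛ a) *ₛ (s *ₛ (b *ₛ x)) ≡⟨ x∙yz≈y∙xz (x *ₛ a) s (b *ₛ x) ⟩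
  s *ₛ ((x *ₛ a) *ₛ (b *ₛ x)) ≡⟨ cong (s *ₛ_) (cong₂ _*ₛ_ (Signₚ.*-comm x a) (Signₚ.*-comm b x)) ⟩
  s *ₛ ((a *ₛ x) *ₛ (x *ₛ b)) ≡⟨ cong (s *ₛ_) ([a*b]*[b*c]≡a*c a x b) ⟩
  s *ₛ (a *ₛ b)               ∎

a*[s*[b*[s*c]]]≡b*[a*c] : ∀ a s b c → a *ₛ (s *ₛ (b *ₛ (s *ₛ c))) ≡ b *ₛ (a *ₛ c)
a*[s*[b*[s*c]]]≡b*[a*c] a s b c = begin
  a *ₛ (s *ₛ (b *ₛ (s *ₛ c))) ≡⟨ cong (a *ₛ_) (x∙yz≈y∙xz s b (s *ₛ c)) ⟩
  a *ₛ (b *ₛ (s *ₛ (s *ₛ c))) ≡⟨ cong (λ z → a *ₛ (b *ₛ z)) (s*[s*t]≡t s c) ⟩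
  a *ₛ (b *ₛ c)               ≡⟨ x∙yz≈y∙xz a b c ⟩
  b *ₛ (a *ₛ c)               ∎

[b*[s*+]]*[a*[s*c]]≡b*[a*c] : ∀ a s b c → (b *ₛ (s *ₛ pos)) *ₛ (a *ₛ (s *ₛ c)) ≡ b *ₛ (a *ₛ c)
[b*[s*+]]*[a*[s*c]]≡b*[a*c] a s b c = begin
  (b *ₛ (s *ₛ pos)) *ₛ (a *ₛ (s *ₛ c)) ≡⟨ cong (λ z → (b *ₛ z) *ₛ (a *ₛ (s *ₛ c))) (Signₚ.*-identityʳ s) ⟩
  (b *ₛ s) *ₛ (a *ₛ (s *ₛ c))           ≡⟨ Signₚ.*-assoc b s (a *ₛ (s *ₛ c)) ⟩
  b *ₛ (s *ₛ (a *ₛ (s *ₛ c)))           ≡⟨ cong (b *ₛ_) (x∙yz≈y∙xz s a (s *ₛ c)) ⟩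
  b *ₛ (a *ₛ (s *ₛ (s *ₛ c)))           ≡⟨ cong (λ z → b *ₛ (a *ₛ z)) (s*[s*t]≡t s c) ⟩
  b *ₛ (a *ₛ c)                         ∎

Unique-++⁻ : ∀ {A : Set} (xs ys : List A) → Unique (xs ++ ys) → Unique xs × Unique ys × Disjoint xs ys
Unique-++⁻ []       ys ys!                     = [] , ys! , λ ()
Unique-++⁻ (x ∷ xs) ys (x∉xs++ys ∷ xs++ys!) with Unique-++⁻ xs ys xs++ys! | All-++⁻ xs x∉xs++ys
... | xs! , ys! , xs#ys | x∉xs , x∉ys = x∉xs ∷ xs! , ys! , disjoint
  where
  disjoint : Disjoint (x ∷ xs) ys
  disjoint (here refl  , v∈ys) = All.lookup x∉ys v∈ys refl
  disjoint (there v∈xs , v∈ys) = xs#ys (v∈xs , v∈ys)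

occurrence-++ : ∀ {A : Set} {x : A} xs ys → Unique (xs ++ ys) → x ∈ₗ xs ++ ys →
  (x ∈ₗ xs × x ∉ₗ ys) ⊎ (x ∉ₗ xs × x ∈ₗ ys)
occurrence-++ xs ys xs++ys! x∈ with Unique-++⁻ xs ys xs++ys! | ∈-++⁻ xs x∈
... | _ , _ , xs#ys | inj₁ x∈xs = inj₁ (x∈xs , λ x∈ys → xs#ys (x∈xs , x∈ys))
... | _ , _ , xs#ys | inj₂ x∈ys = inj₂ ((λ x∈xs → xs#ys (x∈xs , x∈ys)) , x∈ys)

occurrence-++₃ : ∀ {A : Set} {x : A} xs ys zs → Unique (xs ++ ys ++ zs) → x ∈ₗ xs ++ ys ++ zs →
  (x ∈ₗ xs × x ∉ₗ ys × x ∉ₗ zs) ⊎ (x ∉ₗ xs × x ∈ₗ ys × x ∉ₗ zs) ⊎ (x ∉ₗ xs × x ∉ₗ ys × x ∈ₗ zs)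
occurrence-++₃ xs ys zs all! x∈ with occurrence-++ xs (ys ++ zs) all! x∈
... | inj₁ (x∈xs , x∉ys++zs) = inj₁ (x∈xs , x∉ys++zs ∘ ∈-++⁺ˡ , x∉ys++zs ∘ ∈-++⁺ʳ ys)
... | inj₂ (x∉xs , x∈ys++zs) with occurrence-++ ys zs (proj₁ (proj₂ (Unique-++⁻ xs (ys ++ zs) all!))) x∈ys++zs
...   | inj₁ (x∈ys , x∉zs) = inj₂ (inj₁ (x∉xs , x∈ys , x∉zs))
...   | inj₂ (x∉ys , x∈zs) = inj₂ (inj₂ (x∉xs , x∉ys , x∈zs))

module _ {m : ℕ} {p : Subset m} {e : Fin m} where

  ∈-∪⁅⁆⁻ : ∀ {x} → x ∈ p ∪ ⁅ e ⁆ → x ≢ e → x ∈ p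
  ∈-∪⁅⁆⁻ x∈ x≢e with x∈p∪q⁻ p ⁅ e ⁆ x∈
  ... | inj₁ x∈p = x∈p
  ... | inj₂ x∈e = contradiction (x∈⁅y⁆⇒x≡y e x∈e) x≢e

  All-∈-∪⁅⁆⁻ : ∀ {xs} → All (_∈ p ∪ ⁅ e ⁆) xs → e ∉ₗ xs → All (_∈ p) xs
  All-∈-∪⁅⁆⁻ []         _   = []
  All-∈-∪⁅⁆⁻ (x∈ ∷ xs∈) e∉ = ∈-∪⁅⁆⁻ x∈ (λ x≡e → e∉ (here (sym x≡e))) ∷ All-∈-∪⁅⁆⁻ xs∈ (e∉ ∘ there)

  p⊂p∪⁅e⁆ : e ∉ p → p ⊂ p ∪ ⁅ e ⁆
  p⊂p∪⁅e⁆ e∉p = p⊆p∪q ⁅ e ⁆ , e , x∈p∪q⁺ (inj₂ (x∈⁅x⁆ e)) , e∉p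

updateAt-≡ : ∀ {A : Set} {k} (xs : Fin k → A) {i j : Fin k} {a : A} → j ≡ i → updateAt xs i (λ _ → a) j ≡ a
updateAt-≡ xs {i} refl = updateAt-updates i xs

edge2-injective : ∀ {k} {a b c d : Fin k} → edge2 a b ≡ edge2 c d → a ≡ c × b ≡ d
edge2-injective refl = refl , refl

half-injective : ∀ {k} {a b : Fin k} → half a ≡ half b → a ≡ b
half-injective refl = refl

edge2≢half : ∀ {k} {a b c : Fin k} → edge2 a b ≢ half c
edge2≢half ()

loose≢edge2 : ∀ {k} {a b : Fin k} → loose ≢ edge2 a b
loose≢edge2 ()

loose≢half : ∀ {k} {a : Fin k} → loose ≢ half a
loose≢half ()

-- Indexes the values of f by Fin k so that exactly the values satisfying Q
-- get indices below b: the enumeration of components required by BΣ.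
record DenseIndexing {n N : ℕ} (f : Fin n → Fin N) (Q : Fin N → Set) : Set where
  field
    k b        : ℕ
    index      : Fin n → Fin k
    surjective : ∀ i → ∃ λ x → index x ≡ i
    index⇒f    : ∀ x y → index x ≡ index y → f x ≡ f y
    f⇒index    : ∀ x y → f x ≡ f y → index x ≡ index y
    <b⇒Q       : ∀ x → toℕ (index x) < b → Q (f x)
    Q⇒<b       : ∀ x → Q (f x) → toℕ (index x) < b
    b≤k        : b ≤ k

module _ {N : ℕ} {Q : Fin N → Set} where

  indexing-∅ : (f : Fin 0 → Fin N) → DenseIndexing f Q
  indexing-∅ f = record
    { k = 0 ; b = 0 ; index = λ () ; surjective = λ () ; index⇒f = λ () ; f⇒index = λ ()
    ; <b⇒Q = λ () ; Q⇒<b = λ () ; b≤k = z≤n }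

  module _ {n : ℕ} {f : Fin (suc n) → Fin N} (D : DenseIndexing (f ∘ suc) Q) where
    open DenseIndexing D

    extend-seen : ∀ y → f zero ≡ f (suc y) → DenseIndexing f Q
    extend-seen y f₀≡fy = record
      { k = k ; b = b ; index = index′ ; surjective = λ i → let (x , eq) = surjective i in suc x , eq
      ; index⇒f = index⇒f′ ; f⇒index = f⇒index′ ; <b⇒Q = <b⇒Q′ ; Q⇒<b = Q⇒<b′ ; b≤k = b≤k }
      where
      index′ : Fin (suc n) → Fin k
      index′ zero    = index y
      index′ (suc x) = index x
      index⇒f′ : ∀ x z → index′ x ≡ index′ z → f x ≡ f z
      index⇒f′ zero    zero    _  = refl
      index⇒f′ zero    (suc z) eq = trans f₀≡fy (index⇒f y z eq)
      index⇒f′ (suc x) zero    eq = trans (index⇒f x y eq) (sym f₀≡fy)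
      index⇒f′ (suc x) (suc z) eq = index⇒f x z eq
      f⇒index′ : ∀ x z → f x ≡ f z → index′ x ≡ index′ z
      f⇒index′ zero    zero    _  = refl
      f⇒index′ zero    (suc z) eq = f⇒index y z (trans (sym f₀≡fy) eq)
      f⇒index′ (suc x) zero    eq = f⇒index x y (trans eq f₀≡fy)
      f⇒index′ (suc x) (suc z) eq = f⇒index x z eq
      <b⇒Q′ : ∀ x → toℕ (index′ x) < b → Q (f x)
      <b⇒Q′ zero    lt = subst Q (sym f₀≡fy) (<b⇒Q y lt)
      <b⇒Q′ (suc x) lt = <b⇒Q x lt
      Q⇒<b′ : ∀ x → Q (f x) → toℕ (index′ x) < b
      Q⇒<b′ zero    q = Q⇒<b y (subst Q f₀≡fy q)
      Q⇒<b′ (suc x) q = Q⇒<b x q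

    extend-new-Q : (∀ y → f zero ≢ f (suc y)) → Q (f zero) → DenseIndexing f Q
    extend-new-Q unseen q₀ = record
      { k = suc k ; b = suc b ; index = index′ ; surjective = surjective′
      ; index⇒f = index⇒f′ ; f⇒index = f⇒index′ ; <b⇒Q = <b⇒Q′ ; Q⇒<b = Q⇒<b′ ; b≤k = s≤s b≤k }
      where
      index′ : Fin (suc n) → Fin (suc k)
      index′ zero    = zero
      index′ (suc x) = suc (index x)
      surjective′ : ∀ i → ∃ λ x → index′ x ≡ i
      surjective′ zero    = zero , refl
      surjective′ (suc i) = let (x , eq) = surjective i in suc x , cong suc eq
      index⇒f′ : ∀ x z → index′ x ≡ index′ z → f x ≡ f z
      index⇒f′ zero    zero    _  = refl
      index⇒f′ (suc x) (suc z) eq = index⇒f x z (Finₚ.suc-injective eq)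
      f⇒index′ : ∀ x z → f x ≡ f z → index′ x ≡ index′ z
      f⇒index′ zero    zero    _  = refl
      f⇒index′ zero    (suc z) eq = contradiction eq (unseen z)
      f⇒index′ (suc x) zero    eq = contradiction (sym eq) (unseen x)
      f⇒index′ (suc x) (suc z) eq = cong suc (f⇒index x z eq)
      <b⇒Q′ : ∀ x → toℕ (index′ x) < suc b → Q (f x)
      <b⇒Q′ zero    _        = q₀
      <b⇒Q′ (suc x) (s≤s lt) = <b⇒Q x lt
      Q⇒<b′ : ∀ x → Q (f x) → toℕ (index′ x) < suc b
      Q⇒<b′ zero    _ = s≤s z≤n
      Q⇒<b′ (suc x) q = s≤s (Q⇒<b x q)

    extend-new-¬Q : (∀ y → f zero ≢ f (suc y)) → ¬ Q (f zero) → DenseIndexing f Q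
    extend-new-¬Q unseen ¬q₀ = record
      { k = suc k ; b = b ; index = index′ ; surjective = surjective′
      ; index⇒f = index⇒f′ ; f⇒index = f⇒index′ ; <b⇒Q = <b⇒Q′ ; Q⇒<b = Q⇒<b′ ; b≤k = ℕₚ.m≤n⇒m≤1+n b≤k }
      where
      index′ : Fin (suc n) → Fin (suc k)
      index′ zero    = fromℕ k
      index′ (suc x) = inject₁ (index x)
      surjective′ : ∀ i → ∃ λ x → index′ x ≡ i
      surjective′ i with k ℕₚ.≟ toℕ i
      ... | yes k≡i = zero , Finₚ.toℕ-injective (trans (Finₚ.toℕ-fromℕ k) k≡i)
      ... | no k≢i  = let (x , eq) = surjective (lower₁ i k≢i) in
                      suc x , trans (cong inject₁ eq) (Finₚ.inject₁-lower₁ i k≢i)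
      index⇒f′ : ∀ x z → index′ x ≡ index′ z → f x ≡ f z
      index⇒f′ zero    zero    _  = refl
      index⇒f′ zero    (suc z) eq = contradiction eq Finₚ.fromℕ≢inject₁
      index⇒f′ (suc x) zero    eq = contradiction (sym eq) Finₚ.fromℕ≢inject₁
      index⇒f′ (suc x) (suc z) eq = index⇒f x z (Finₚ.inject₁-injective eq)
      f⇒index′ : ∀ x z → f x ≡ f z → index′ x ≡ index′ z
      f⇒index′ zero    zero    _  = refl
      f⇒index′ zero    (suc z) eq = contradiction eq (unseen z)
      f⇒index′ (suc x) zero    eq = contradiction (sym eq) (unseen x)
      f⇒index′ (suc x) (suc z) eq = cong inject₁ (f⇒index x z eq)
      <b⇒Q′ : ∀ x → toℕ (index′ x) < b → Q (f x)
      <b⇒Q′ zero    lt = contradiction b≤k (ℕₚ.<⇒≱ (subst (_< b) (Finₚ.toℕ-fromℕ k) lt))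
      <b⇒Q′ (suc x) lt = <b⇒Q x (subst (_< b) (Finₚ.toℕ-inject₁ (index x)) lt)
      Q⇒<b′ : ∀ x → Q (f x) → toℕ (index′ x) < b
      Q⇒<b′ zero    q = contradiction q ¬q₀
      Q⇒<b′ (suc x) q = subst (_< b) (sym (Finₚ.toℕ-inject₁ (index x))) (Q⇒<b x q)

  denseIndexing : ∀ {n} (f : Fin n → Fin N) → (∀ i → Dec (Q i)) → DenseIndexing f Q
  denseIndexing {zero}  f Q? = indexing-∅ f
  denseIndexing {suc n} f Q? with Finₚ.any? (λ y → f zero Finₚ.≟ f (suc y))
  ... | yes (y , f₀≡fy) = extend-seen (denseIndexing (f ∘ suc) Q?) y f₀≡fy
  ... | no unseen with Q? (f zero)
  ...   | yes q₀  = extend-new-Q  (denseIndexing (f ∘ suc) Q?) (λ y eq → unseen (y , eq)) q₀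
  ...   | no ¬q₀ = extend-new-¬Q (denseIndexing (f ∘ suc) Q?) (λ y eq → unseen (y , eq)) ¬q₀

module _ {c ℓ : Level} {K : Field c ℓ} {n m : ℕ} (G : GSG K n m) where
  open GSG G

  private
    module Vertices = DecMembership (Finₚ._≟_ {n})
    module Edges    = DecMembership (Finₚ._≟_ {m})

  infixr 5 _⊕_
  _⊕_ : ∀ {u v w} → Walk G u v → Walk G v w → Walk G u w
  _⊕_ = _++W_ G

  len : ∀ {u v} → Walk G u v → ℕ
  len W = length (edgesW G W)

  edgesW-⊕ : ∀ {u v w} (W₁ : Walk G u v) (W₂ : Walk G v w) →
             edgesW G (W₁ ⊕ W₂) ≡ edgesW G W₁ ++ edgesW G W₂
  edgesW-⊕ []       W₂ = refl
  edgesW-⊕ (s ∷ W₁) W₂ = cong (stepEdge G s ∷_) (edgesW-⊕ W₁ W₂)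

  walkSign-⊕ : ∀ {u v w} (W₁ : Walk G u v) (W₂ : Walk G v w) →
               walkSign G (W₁ ⊕ W₂) ≡ walkSign G W₁ *ₛ walkSign G W₂
  walkSign-⊕ []       W₂ = refl
  walkSign-⊕ (s ∷ W₁) W₂ = trans (cong (σ (stepEdge G s) *ₛ_) (walkSign-⊕ W₁ W₂))
                                 (sym (Signₚ.*-assoc (σ (stepEdge G s)) (walkSign G W₁) (walkSign G W₂)))

  len-⊕ : ∀ {u v w} (W₁ : Walk G u v) (W₂ : Walk G v w) → len (W₁ ⊕ W₂) ≡ len W₁ + len W₂
  len-⊕ W₁ W₂ = trans (cong length (edgesW-⊕ W₁ W₂)) (length-++ (edgesW G W₁))

  len-⊕-≤ʳ : ∀ {u v w} (W₁ : Walk G u v) (W₂ : Walk G v w) → len W₂ ≤ len (W₁ ⊕ W₂)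
  len-⊕-≤ʳ W₁ W₂ rewrite len-⊕ W₁ W₂ = ℕₚ.m≤n+m (len W₂) (len W₁)

  len-<-⊕∷ : ∀ {u v w x} (W₁ : Walk G u v) (s : Step G v w) (W₂ : Walk G w x) → len W₁ < len (W₁ ⊕ (s ∷ W₂))
  len-<-⊕∷ W₁ s W₂ rewrite len-⊕ W₁ (s ∷ W₂) = ℕₚ.m<m+n (len W₁) (s≤s z≤n)

  len-⊕-monoʳ-≤ : ∀ {u v w w′} (W₁ : Walk G u v) {W₂ : Walk G v w} {W₃ : Walk G v w′} →
                  len W₃ ≤ len W₂ → len (W₁ ⊕ W₃) ≤ len (W₁ ⊕ W₂)
  len-⊕-monoʳ-≤ W₁ {W₂} {W₃} le rewrite len-⊕ W₁ W₂ | len-⊕ W₁ W₃ = ℕₚ.+-monoʳ-≤ (len W₁) le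

  len-⊕-monoʳ-< : ∀ {u v w w′} (W₁ : Walk G u v) {W₂ : Walk G v w} {W₃ : Walk G v w′} →
                  len W₃ < len W₂ → len (W₁ ⊕ W₃) < len (W₁ ⊕ W₂)
  len-⊕-monoʳ-< W₁ {W₂} {W₃} lt rewrite len-⊕ W₁ W₂ | len-⊕ W₁ W₃ = ℕₚ.+-monoʳ-< (len W₁) lt

  All-⊕⁺ : ∀ {P : Fin m → Set} {u v w} (W₁ : Walk G u v) (W₂ : Walk G v w) →
           All P (edgesW G W₁) → All P (edgesW G W₂) → All P (edgesW G (W₁ ⊕ W₂))
  All-⊕⁺ W₁ W₂ W₁⊆ W₂⊆ = subst (All _) (sym (edgesW-⊕ W₁ W₂)) (All-++⁺ W₁⊆ W₂⊆)

  All-⊕⁻ : ∀ {P : Fin m → Set} {u v w} (W₁ : Walk G u v) (W₂ : Walk G v w) →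
           All P (edgesW G (W₁ ⊕ W₂)) → All P (edgesW G W₁) × All P (edgesW G W₂)
  All-⊕⁻ W₁ W₂ W⊆ = All-++⁻ (edgesW G W₁) (subst (All _) (edgesW-⊕ W₁ W₂) W⊆)

  step-kind : ∀ {u v} (s : Step G u v) → kind (stepEdge G s) ≡ edge2 u v ⊎ kind (stepEdge G s) ≡ edge2 v u
  step-kind (fwd e k) = inj₁ k
  step-kind (bwd e k) = inj₂ k

  step-ends : ∀ {e p q a b} → kind e ≡ edge2 p q → (s : Step G a b) → stepEdge G s ≡ e →
              (a ≡ p × b ≡ q) ⊎ (a ≡ q × b ≡ p)
  step-ends ke (fwd e k) refl = inj₁ (edge2-injective (trans (sym k) ke))
  step-ends ke (bwd e k) refl = let (b≡p , a≡q) = edge2-injective (trans (sym k) ke) in inj₂ (a≡q , b≡p)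

  same-edge-steps : ∀ {a b a′ b′} (s : Step G a b) (s′ : Step G a′ b′) → stepEdge G s ≡ stepEdge G s′ →
                    (a′ ≡ a × b′ ≡ b) ⊎ (a′ ≡ b × b′ ≡ a)
  same-edge-steps s s′ same with step-kind s
  ... | inj₁ k = step-ends k s′ (sym same)
  ... | inj₂ k = swap (step-ends k s′ (sym same))

  half∉walk : ∀ {e a x y} (W : Walk G x y) → kind e ≡ half a → e ∉ₗ edgesW G W
  half∉walk (s ∷ W) ke (here refl) with step-kind s
  ... | inj₁ k = edge2≢half (trans (sym k) ke)
  ... | inj₂ k = edge2≢half (trans (sym k) ke)
  half∉walk (s ∷ W) ke (there e∈W) = half∉walk W ke e∈W

  start∈verts : ∀ {x y} (W : Walk G x y) → x ∈ₗ verts G W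
  start∈verts []      = here refl
  start∈verts (s ∷ W) = here refl

  ends∈verts : ∀ {e a b x y} (W : Walk G x y) → e ∈ₗ edgesW G W → kind e ≡ edge2 a b →
               a ∈ₗ verts G W × b ∈ₗ verts G W
  ends∈verts (s ∷ W) (here refl) ke with step-kind s
  ... | inj₁ k with edge2-injective (trans (sym ke) k)
  ...   | refl , refl = here refl , there (start∈verts W)
  ends∈verts (s ∷ W) (here refl) ke | inj₂ k with edge2-injective (trans (sym ke) k)
  ...   | refl , refl = there (start∈verts W) , here refl
  ends∈verts (s ∷ W) (there e∈W) ke = let (a∈ , b∈) = ends∈verts W e∈W ke in there a∈ , there b∈

  path-unique : ∀ {x y} (W : Walk G x y) → IsPath G W → Unique (edgesW G W)
  path-unique []      _             = []
  path-unique (s ∷ W) (x∉W ∷ path) = All.tabulate (λ z∈W s≡z → source∉W (subst (_∈ₗ edgesW G W) (sym s≡z) z∈W))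
                                     ∷ path-unique W path
    where
    source∉W : stepEdge G s ∉ₗ edgesW G W
    source∉W s∈W with step-kind s
    ... | inj₁ k = All.lookup x∉W (proj₁ (ends∈verts W s∈W k)) refl
    ... | inj₂ k = All.lookup x∉W (proj₂ (ends∈verts W s∈W k)) refl

  circle-unique : ∀ {u} (C : Walk G u u) → IsCircle G C → Unique (edgesW G C)
  circle-unique (s ∷ C) (_ , edges!) = edges!

  Reach : (Fin m → Set) → Fin n → Fin n → Set
  Reach P x y = Σ (Walk G x y) λ W → All P (edgesW G W)

  module _ {P : Fin m → Set} where

    reach-refl : ∀ {x} → Reach P x x
    reach-refl = [] , []

    reach-trans : ∀ {x y z} → Reach P x y → Reach P y z → Reach P x z
    reach-trans (W₁ , W₁⊆) (W₂ , W₂⊆) = W₁ ⊕ W₂ , All-⊕⁺ W₁ W₂ W₁⊆ W₂⊆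

    reach-map : ∀ {Q : Fin m → Set} → (∀ {e} → P e → Q e) → ∀ {x y} → Reach P x y → Reach Q x y
    reach-map P⇒Q (W , W⊆) = W , All.map P⇒Q W⊆

  -- A negative closed walk rather than a circle, unlike in BalancedAt.
  Unbalancing : (Fin m → Set) → Fin n → Set
  Unbalancing P x =
    (Σ (Fin n) λ u → Σ (Fin m) λ h → kind h ≡ half u × P h × Reach P x u) ⊎
    (Σ (Fin n) λ u → Σ (Walk G u u) λ C → walkSign G C ≡ neg × All P (edgesW G C) × Reach P x u)

  module _ {P : Fin m → Set} where

    unbalancing-map : ∀ {Q : Fin m → Set} → (∀ {e} → P e → Q e) → ∀ {x} → Unbalancing P x → Unbalancing Q x
    unbalancing-map P⇒Q (inj₁ (u , h , kh , h∈ , x⇝u))  = inj₁ (u , h , kh , P⇒Q h∈ , reach-map P⇒Q x⇝u)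
    unbalancing-map P⇒Q (inj₂ (u , C , C-neg , C⊆ , x⇝u)) = inj₂ (u , C , C-neg , All.map P⇒Q C⊆ , reach-map P⇒Q x⇝u)

    unbalancing-reach : ∀ {x y} → Reach P x y → Unbalancing P y → Unbalancing P x
    unbalancing-reach x⇝y (inj₁ (u , h , kh , h∈ , y⇝u))  = inj₁ (u , h , kh , h∈ , reach-trans x⇝y y⇝u)
    unbalancing-reach x⇝y (inj₂ (u , C , C-neg , C⊆ , y⇝u)) = inj₂ (u , C , C-neg , C⊆ , reach-trans x⇝y y⇝u)

  -- The components of (V, P), each labelled by one of its vertices, with a
  -- switching function ζ that is consistent on the sign-balanced components.
  record Components (P : Fin m → Set) : Set where
    field
      label         : Fin n → Fin n
      balancedLabel : Fin n → Bool
      ζ             : Fin n → Sign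

    IsBalanced : Fin n → Set
    IsBalanced x = T (balancedLabel (label x))

    field
      label-reach : ∀ x y → label x ≡ label y → Reach P x y
      label-edge  : ∀ e p q → P e → kind e ≡ edge2 p q → label p ≡ label q
      ζ-edge      : ∀ e p q → P e → kind e ≡ edge2 p q → IsBalanced p → ζ p *ₛ ζ q ≡ σ e
      no-half     : ∀ h p → P h → kind h ≡ half p → ¬ IsBalanced p
      unbalancing : ∀ x → ¬ IsBalanced x → Unbalancing P x

    label-step : ∀ {x y} (s : Step G x y) → P (stepEdge G s) → label x ≡ label y
    label-step (fwd e k) e∈ = label-edge e _ _ e∈ k
    label-step (bwd e k) e∈ = sym (label-edge e _ _ e∈ k)

    label-walk : ∀ {x y} (W : Walk G x y) → All P (edgesW G W) → label x ≡ label y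
    label-walk []      _          = refl
    label-walk (s ∷ W) (s∈ ∷ W⊆) = trans (label-step s s∈) (label-walk W W⊆)

    balanced-resp : ∀ {x y} → label x ≡ label y → IsBalanced x → IsBalanced y
    balanced-resp x∼y = subst (T ∘ balancedLabel) x∼y

    ζ-step : ∀ {x y} (s : Step G x y) → P (stepEdge G s) → IsBalanced x → σ (stepEdge G s) ≡ ζ x *ₛ ζ y
    ζ-step (fwd e k) e∈ bx = sym (ζ-edge e _ _ e∈ k bx)
    ζ-step {x} {y} (bwd e k) e∈ bx =
      trans (sym (ζ-edge e y x e∈ k (balanced-resp (sym (label-edge e y x e∈ k)) bx)))
            (Signₚ.*-comm (ζ y) (ζ x))

    ζ-walk : ∀ {x y} (W : Walk G x y) → All P (edgesW G W) → IsBalanced x → walkSign G W ≡ ζ x *ₛ ζ y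
    ζ-walk {x} []      _ _ = sym (Signₚ.s*s≡+ (ζ x))
    ζ-walk {x} {y} (_∷_ {v = z} s W) (s∈ ∷ W⊆) bx = begin
      σ (stepEdge G s) *ₛ walkSign G W
        ≡⟨ cong₂ _*ₛ_ (ζ-step s s∈ bx) (ζ-walk W W⊆ (balanced-resp (label-step s s∈) bx)) ⟩
      (ζ x *ₛ ζ z) *ₛ (ζ z *ₛ ζ y)
        ≡⟨ [a*b]*[b*c]≡a*c (ζ x) (ζ z) (ζ y) ⟩
      ζ x *ₛ ζ y ∎

    closed-walk-positive : ∀ {x} (C : Walk G x x) → All P (edgesW G C) → IsBalanced x → walkSign G C ≡ pos
    closed-walk-positive {x} C C⊆ bx = trans (ζ-walk C C⊆ bx) (Signₚ.s*s≡+ (ζ x))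

  Insert : (Fin m → Set) → Fin m → Fin m → Set
  Insert P e x = P x ⊎ x ≡ e

  components-∅ : ∀ {P} → (∀ {x} → ¬ P x) → Components P
  components-∅ ∅ = record
    { label = id ; balancedLabel = λ _ → true ; ζ = λ _ → pos
    ; label-reach = λ x y x≡y → subst (Reach _ x) x≡y reach-refl
    ; label-edge = λ _ _ _ e∈ → ⊥-elim (∅ e∈)
    ; ζ-edge = λ _ _ _ e∈ → ⊥-elim (∅ e∈)
    ; no-half = λ _ _ h∈ → ⊥-elim (∅ h∈)
    ; unbalancing = λ _ ¬bx → ⊥-elim (¬bx tt) }

  Components-resp : ∀ {P Q} → (∀ {x} → P x → Q x) → (∀ {x} → Q x → P x) → Components P → Components Q
  Components-resp P⇒Q Q⇒P C = record
    { label = label ; balancedLabel = balancedLabel ; ζ = ζ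
    ; label-reach = λ x y x∼y → reach-map P⇒Q (label-reach x y x∼y)
    ; label-edge = λ e p q e∈ → label-edge e p q (Q⇒P e∈)
    ; ζ-edge = λ e p q e∈ → ζ-edge e p q (Q⇒P e∈)
    ; no-half = λ h p h∈ → no-half h p (Q⇒P h∈)
    ; unbalancing = λ x ¬bx → unbalancing-map P⇒Q (unbalancing x ¬bx) }
    where open Components C

  module _ {P : Fin m → Set} (C : Components P) where
    open Components C

    -- What an edge of kind k and sign s must satisfy to be added without
    -- changing the components, their balance or ζ.
    Compatible : EdgeKind n → Sign → Set
    Compatible loose       _ = Unit
    Compatible (half p)    _ = ¬ IsBalanced p
    Compatible (edge2 p q) s = label p ≡ label q × (IsBalanced p → ζ p *ₛ ζ q ≡ s)

    insert-compatible : ∀ e {k} → kind e ≡ k → Compatible k (σ e) → Components (Insert P e)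
    insert-compatible e ke fits = record
      { label = label ; balancedLabel = balancedLabel ; ζ = ζ
      ; label-reach = λ x y x∼y → reach-map inj₁ (label-reach x y x∼y)
      ; label-edge = label-edge′ ; ζ-edge = ζ-edge′ ; no-half = no-half′
      ; unbalancing = λ x ¬bx → unbalancing-map inj₁ (unbalancing x ¬bx) }
      where
      fits-at : ∀ {k′} → kind e ≡ k′ → Compatible k′ (σ e)
      fits-at ke′ = subst (λ k → Compatible k (σ e)) (trans (sym ke) ke′) fits
      label-edge′ : ∀ e′ p q → Insert P e e′ → kind e′ ≡ edge2 p q → label p ≡ label q
      label-edge′ e′ p q (inj₁ e′∈) k = label-edge e′ p q e′∈ k
      label-edge′ _  p q (inj₂ refl) k = proj₁ (fits-at k)
      ζ-edge′ : ∀ e′ p q → Insert P e e′ → kind e′ ≡ edge2 p q → IsBalanced p → ζ p *ₛ ζ q ≡ σ e′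
      ζ-edge′ e′ p q (inj₁ e′∈) k = ζ-edge e′ p q e′∈ k
      ζ-edge′ _  p q (inj₂ refl) k = proj₂ (fits-at k)
      no-half′ : ∀ h p → Insert P e h → kind h ≡ half p → ¬ IsBalanced p
      no-half′ h p (inj₁ h∈)   k = no-half h p h∈ k
      no-half′ _ p (inj₂ refl) k = fits-at k

    InClassOf : Fin n → EdgeKind n → Set
    InClassOf p₀ loose       = ⊥
    InClassOf p₀ (half p)    = label p ≡ label p₀
    InClassOf p₀ (edge2 p q) = label p ≡ label p₀ × label q ≡ label p₀

    insert-unbalancing : ∀ e {k} p₀ → kind e ≡ k → InClassOf p₀ k → Unbalancing (Insert P e) p₀ →
                         Components (Insert P e)
    insert-unbalancing e p₀ ke inClass w₀ = record
      { label = label ; balancedLabel = balancedLabel′ ; ζ = ζ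
      ; label-reach = λ x y x∼y → reach-map inj₁ (label-reach x y x∼y)
      ; label-edge = label-edge′ ; ζ-edge = ζ-edge′ ; no-half = no-half′ ; unbalancing = unbalancing′ }
      where
      balancedLabel′ : Fin n → Bool
      balancedLabel′ = updateAt balancedLabel (label p₀) (λ _ → false)
      in-class : ∀ {k′} → kind e ≡ k′ → InClassOf p₀ k′
      in-class ke′ = subst (InClassOf p₀) (trans (sym ke) ke′) inClass
      still-balanced : ∀ x → T (balancedLabel′ (label x)) → IsBalanced x × label x ≢ label p₀
      still-balanced x bx with label x Finₚ.≟ label p₀
      ... | yes x∼p₀ = ⊥-elim (subst T (updateAt-≡ balancedLabel x∼p₀) bx)
      ... | no x≁p₀  = subst T (updateAt-minimal _ _ balancedLabel x≁p₀) bx , x≁p₀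
      label-edge′ : ∀ e′ p q → Insert P e e′ → kind e′ ≡ edge2 p q → label p ≡ label q
      label-edge′ e′ p q (inj₁ e′∈) k = label-edge e′ p q e′∈ k
      label-edge′ _  p q (inj₂ refl) k = trans (proj₁ (in-class k)) (sym (proj₂ (in-class k)))
      ζ-edge′ : ∀ e′ p q → Insert P e e′ → kind e′ ≡ edge2 p q → T (balancedLabel′ (label p)) → ζ p *ₛ ζ q ≡ σ e′
      ζ-edge′ e′ p q (inj₁ e′∈) k bp = ζ-edge e′ p q e′∈ k (proj₁ (still-balanced p bp))
      ζ-edge′ _  p q (inj₂ refl) k bp = contradiction (proj₁ (in-class k)) (proj₂ (still-balanced p bp))
      no-half′ : ∀ h p → Insert P e h → kind h ≡ half p → ¬ T (balancedLabel′ (label p))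
      no-half′ h p (inj₁ h∈)   k bp = no-half h p h∈ k (proj₁ (still-balanced p bp))
      no-half′ _ p (inj₂ refl) k bp = proj₂ (still-balanced p bp) (in-class k)
      unbalancing′ : ∀ x → ¬ T (balancedLabel′ (label x)) → Unbalancing (Insert P e) x
      unbalancing′ x ¬bx with label x Finₚ.≟ label p₀
      ... | yes x∼p₀ = unbalancing-reach (reach-map inj₁ (label-reach x p₀ x∼p₀)) w₀
      ... | no x≁p₀  = unbalancing-map inj₁
                         (unbalancing x (¬bx ∘ subst T (sym (updateAt-minimal _ _ balancedLabel x≁p₀))))

    inconsistent-cycle : ∀ e {p q} → kind e ≡ edge2 p q → label p ≡ label q → IsBalanced p →
                         ζ p *ₛ ζ q ≢ σ e → Unbalancing (Insert P e) p
    inconsistent-cycle e {p} {q} ke p∼q bp inconsistent =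
      inj₂ (p , W ⊕ (bwd e ke ∷ []) , negative , All-⊕⁺ W _ (All.map inj₁ W⊆) (inj₂ refl ∷ []) , reach-refl)
      where
      W : Walk G p q
      W = proj₁ (label-reach p q p∼q)
      W⊆ : All P (edgesW G W)
      W⊆ = proj₂ (label-reach p q p∼q)
      negative : walkSign G (W ⊕ (bwd e ke ∷ [])) ≡ neg
      negative = begin
        walkSign G (W ⊕ (bwd e ke ∷ []))  ≡⟨ walkSign-⊕ W (bwd e ke ∷ []) ⟩
        walkSign G W *ₛ (σ e *ₛ pos)      ≡⟨ cong₂ _*ₛ_ (ζ-walk W W⊆ bp) (Signₚ.*-identityʳ (σ e)) ⟩
        (ζ p *ₛ ζ q) *ₛ σ e               ≡⟨ ≢⇒*ₛ≡neg inconsistent ⟩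
        neg                               ∎

    -- The classes of p₀ and q₀ are merged under the label of p₀; the switching
    -- function of the q₀ class is multiplied by t to make e consistent.
    module Bridge (e : Fin m) {p₀ q₀ : Fin n} (ke : kind e ≡ edge2 p₀ q₀) (apart : label p₀ ≢ label q₀) where

      t : Sign
      t = ζ q₀ *ₛ (ζ p₀ *ₛ σ e)

      rename : Fin n → Fin n
      rename = updateAt id (label q₀) (λ _ → label p₀)

      label′ : Fin n → Fin n
      label′ = rename ∘ label

      shift : Fin n → Sign
      shift = updateAt (λ _ → pos) (label q₀) (λ _ → t)

      ζ′ : Fin n → Sign
      ζ′ x = ζ x *ₛ shift (label x)

      balancedLabel′ : Fin n → Bool
      balancedLabel′ = updateAt balancedLabel (label p₀) (λ _ → balancedLabel (label p₀) ∧ balancedLabel (label q₀))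

      renamed-other : ∀ {x} → label x ≢ label q₀ → label′ x ≡ label x
      renamed-other x≁q₀ = updateAt-minimal _ _ id x≁q₀

      merged : ∀ x → label′ x ≡ label p₀ → label x ≡ label p₀ ⊎ label x ≡ label q₀
      merged x x∼p₀ with label x Finₚ.≟ label q₀
      ... | yes x∼q₀ = inj₂ x∼q₀
      ... | no x≁q₀  = inj₁ (trans (sym (renamed-other x≁q₀)) x∼p₀)

      unmerged : ∀ x → label′ x ≢ label p₀ → label′ x ≡ label x
      unmerged x x≁p₀ with label x Finₚ.≟ label q₀
      ... | yes x∼q₀ = contradiction (updateAt-≡ id x∼q₀) x≁p₀
      ... | no x≁q₀  = renamed-other x≁q₀

      old : ∀ {x y} → label x ≡ label y → Reach (Insert P e) x y
      old {x} {y} x∼y = reach-map inj₁ (label-reach x y x∼y)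

      reach-to-p₀ : ∀ x → label′ x ≡ label p₀ → Reach (Insert P e) x p₀
      reach-to-p₀ x x∼p₀ with merged x x∼p₀
      ... | inj₁ x∼p₀′ = old x∼p₀′
      ... | inj₂ x∼q₀  = reach-trans (old x∼q₀) (bwd e ke ∷ [] , inj₂ refl ∷ [])

      reach-from-p₀ : ∀ x → label′ x ≡ label p₀ → Reach (Insert P e) p₀ x
      reach-from-p₀ x x∼p₀ with merged x x∼p₀
      ... | inj₁ x∼p₀′ = old (sym x∼p₀′)
      ... | inj₂ x∼q₀  = reach-trans (fwd e ke ∷ [] , inj₂ refl ∷ []) (old (sym x∼q₀))

      label′-reach : ∀ x y → label′ x ≡ label′ y → Reach (Insert P e) x y
      label′-reach x y x∼y with label′ x Finₚ.≟ label p₀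
      ... | yes x∼p₀ = reach-trans (reach-to-p₀ x x∼p₀) (reach-from-p₀ y (trans (sym x∼y) x∼p₀))
      ... | no x≁p₀  = old (trans (sym (unmerged x x≁p₀)) (trans x∼y (unmerged y (x≁p₀ ∘ trans x∼y))))

      label′-edge : ∀ e′ p q → Insert P e e′ → kind e′ ≡ edge2 p q → label′ p ≡ label′ q
      label′-edge e′ p q (inj₁ e′∈) k = cong rename (label-edge e′ p q e′∈ k)
      label′-edge _  p q (inj₂ refl) k with edge2-injective (trans (sym ke) k)
      ... | refl , refl = trans (renamed-other apart) (sym (updateAt-≡ id refl))

      balanced′⇒balanced : ∀ x → T (balancedLabel′ (label′ x)) → IsBalanced x
      balanced′⇒balanced x bx with label′ x Finₚ.≟ label p₀
      ... | no x≁p₀ = subst T (trans (updateAt-minimal _ _ balancedLabel x≁p₀) (cong balancedLabel (unmerged x x≁p₀))) bx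
      ... | yes x∼p₀ with to T-∧ (subst T (updateAt-≡ balancedLabel x∼p₀) bx) | merged x x∼p₀
      ...   | bp , _  | inj₁ x∼p₀′ = balanced-resp (sym x∼p₀′) bp
      ...   | _  , bq | inj₂ x∼q₀  = balanced-resp (sym x∼q₀) bq

      ζ′-edge : ∀ e′ p q → Insert P e e′ → kind e′ ≡ edge2 p q → T (balancedLabel′ (label′ p)) → ζ′ p *ₛ ζ′ q ≡ σ e′
      ζ′-edge e′ p q (inj₁ e′∈) k bp = begin
        (ζ p *ₛ shift (label p)) *ₛ (ζ q *ₛ shift (label q)) ≡⟨ cong (λ ℓ → (ζ p *ₛ shift ℓ) *ₛ (ζ q *ₛ shift (label q))) p∼q ⟩
        (ζ p *ₛ shift (label q)) *ₛ (ζ q *ₛ shift (label q)) ≡⟨ [a*s]*[b*s]≡a*b (ζ p) (ζ q) (shift (label q)) ⟩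
        ζ p *ₛ ζ q                                           ≡⟨ ζ-edge e′ p q e′∈ k (balanced′⇒balanced p bp) ⟩
        σ e′                                                 ∎
        where p∼q = label-edge e′ p q e′∈ k
      ζ′-edge _ p q (inj₂ refl) k _ with edge2-injective (trans (sym ke) k)
      ... | refl , refl = begin
        (ζ p₀ *ₛ shift (label p₀)) *ₛ (ζ q₀ *ₛ shift (label q₀))
          ≡⟨ cong₂ (λ s s′ → (ζ p₀ *ₛ s) *ₛ (ζ q₀ *ₛ s′)) (updateAt-minimal _ _ (λ _ → pos) apart) (updateAt-≡ (λ _ → pos) {label q₀} refl) ⟩
        (ζ p₀ *ₛ pos) *ₛ (ζ q₀ *ₛ t)
          ≡⟨ cong₂ _*ₛ_ (Signₚ.*-identityʳ (ζ p₀)) (s*[s*t]≡t (ζ q₀) (ζ p₀ *ₛ σ e)) ⟩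
        ζ p₀ *ₛ (ζ p₀ *ₛ σ e)
          ≡⟨ s*[s*t]≡t (ζ p₀) (σ e) ⟩
        σ e ∎

      no-half′ : ∀ h p → Insert P e h → kind h ≡ half p → ¬ T (balancedLabel′ (label′ p))
      no-half′ h p (inj₁ h∈)   k bp = no-half h p h∈ k (balanced′⇒balanced p bp)
      no-half′ _ p (inj₂ refl) k _  = edge2≢half (trans (sym ke) k)

      unbalancing′ : ∀ x → ¬ T (balancedLabel′ (label′ x)) → Unbalancing (Insert P e) x
      unbalancing′ x ¬bx with label′ x Finₚ.≟ label p₀
      ... | no x≁p₀ = unbalancing-map inj₁ (unbalancing x (¬bx ∘ subst T
                        (sym (trans (updateAt-minimal _ _ balancedLabel x≁p₀) (cong balancedLabel (unmerged x x≁p₀))))))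
      ... | yes x∼p₀ with T? (balancedLabel (label p₀))
      ...   | no ¬bp = unbalancing-reach (reach-to-p₀ x x∼p₀) (unbalancing-map inj₁ (unbalancing p₀ ¬bp))
      ...   | yes bp = unbalancing-reach (reach-trans (reach-to-p₀ x x∼p₀) (fwd e ke ∷ [] , inj₂ refl ∷ []))
                         (unbalancing-map inj₁ (unbalancing q₀ λ bq →
                           ¬bx (subst T (sym (updateAt-≡ balancedLabel x∼p₀)) (from T-∧ (bp , bq)))))

      components : Components (Insert P e)
      components = record
        { label = label′ ; balancedLabel = balancedLabel′ ; ζ = ζ′
        ; label-reach = label′-reach ; label-edge = label′-edge ; ζ-edge = ζ′-edge
        ; no-half = no-half′ ; unbalancing = unbalancing′ }

    insertEdge : ∀ e → Components (Insert P e)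
    insertEdge e with kind e in ke
    ... | loose  = insert-compatible e ke tt
    ... | half p = insert-unbalancing e p ke refl (inj₁ (p , e , ke , inj₂ refl , reach-refl))
    ... | edge2 p q with label p Finₚ.≟ label q
    ...   | no apart = Bridge.components e ke apart
    ...   | yes p∼q with ζ p *ₛ ζ q Signₚ.≟ σ e
    ...     | yes consistent = insert-compatible e ke (p∼q , λ _ → consistent)
    ...     | no inconsistent with T? (balancedLabel (label p))
    ...       | yes bp  = insert-unbalancing e p ke (refl , sym p∼q) (inconsistent-cycle e ke p∼q bp inconsistent)
    ...       | no ¬bp = insert-compatible e ke (p∼q , λ bp → contradiction bp ¬bp)

  components-of : ∀ S → Components (_∈ S)
  components-of S = Components-resp proj₂ (λ x∈S → ∈-allFin _ , x∈S) (over (allFin m))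
    where
    over : ∀ L → Components (λ x → x ∈ₗ L × x ∈ S)
    over []      = components-∅ λ { (() , _) }
    over (e ∷ L) with e ∈? S
    ... | yes e∈S = Components-resp
                      (λ { (inj₁ (x∈L , x∈S)) → there x∈L , x∈S ; (inj₂ refl) → here refl , e∈S })
                      (λ { (here refl , _) → inj₂ refl ; (there x∈L , x∈S) → inj₁ (x∈L , x∈S) })
                      (insertEdge (over L) e)
    ... | no e∉S  = Components-resp
                      (λ (x∈L , x∈S) → there x∈L , x∈S)
                      (λ { (here refl , e∈S) → contradiction e∈S e∉S ; (there x∈L , x∈S) → x∈L , x∈S })
                      (over L)

  record EdgeOccurrence {u v} (W : Walk G u v) (e : Fin m) : Set where
    constructor occurrence
    field
      {a b}     : Fin n
      before    : Walk G u a
      step      : Step G a b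
      after     : Walk G b v
      split     : W ≡ before ⊕ (step ∷ after)
      step-edge : stepEdge G step ≡ e

  edgeOccurrence : ∀ {u v e} (W : Walk G u v) → e ∈ₗ edgesW G W → EdgeOccurrence W e
  edgeOccurrence (s ∷ W) (here e≡s)  = occurrence [] s W refl (sym e≡s)
  edgeOccurrence (s ∷ W) (there e∈W) with edgeOccurrence W e∈W
  ... | occurrence W₁ s′ W₂ refl s′≡e = occurrence (s ∷ W₁) s′ W₂ refl s′≡e

  record VertexOccurrence {u v} (W : Walk G u v) (x : Fin n) : Set where
    constructor occurrence
    field
      {y}    : Fin n
      before : Walk G u x
      step   : Step G x y
      after  : Walk G y v
      split  : W ≡ before ⊕ (step ∷ after)

  vertexOccurrence : ∀ {u v x} (W : Walk G u v) → x ∈ₗ initVerts G W → VertexOccurrence W x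
  vertexOccurrence (s ∷ W) (here refl)  = occurrence [] s W refl
  vertexOccurrence (s ∷ W) (there x∈W) with vertexOccurrence W x∈W
  ... | occurrence W₁ s′ W₂ refl = occurrence (s ∷ W₁) s′ W₂ refl

  record RepeatedVertex {u v} (W : Walk G u v) : Set where
    constructor repeated-vertex
    field
      {x y z} : Fin n
      W₁      : Walk G u x
      s       : Step G x y
      W₂      : Walk G y x
      t       : Step G x z
      W₃      : Walk G z v
      split   : W ≡ W₁ ⊕ ((s ∷ W₂) ⊕ (t ∷ W₃))

  vertices-unique-or-repeated : ∀ {u v} (W : Walk G u v) → Unique (initVerts G W) ⊎ RepeatedVertex W
  vertices-unique-or-repeated [] = inj₁ []
  vertices-unique-or-repeated {u} (s ∷ W) with u Vertices.∈? initVerts G W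
  ... | yes u∈W with vertexOccurrence W u∈W
  ...   | occurrence W₁ t W₂ refl = inj₂ (repeated-vertex [] s W₁ t W₂ refl)
  vertices-unique-or-repeated {u} (s ∷ W) | no u∉W with vertices-unique-or-repeated W
  ...   | inj₁ W!                                    = inj₁ (¬Any⇒All¬ _ u∉W ∷ W!)
  ...   | inj₂ (repeated-vertex W₁ s′ W₂ t W₃ refl) = inj₂ (repeated-vertex (s ∷ W₁) s′ W₂ t W₃ refl)

  record RepeatedEdge {u v} (W : Walk G u v) : Set where
    constructor repeated-edge
    field
      {a b a′ b′} : Fin n
      W₁          : Walk G u a
      s           : Step G a b
      W₂          : Walk G b a′
      s′          : Step G a′ b′
      W₃          : Walk G b′ v
      split       : W ≡ W₁ ⊕ (s ∷ (W₂ ⊕ (s′ ∷ W₃)))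
      same        : stepEdge G s ≡ stepEdge G s′

  edges-unique-or-repeated : ∀ {u v} (W : Walk G u v) → Unique (edgesW G W) ⊎ RepeatedEdge W
  edges-unique-or-repeated [] = inj₁ []
  edges-unique-or-repeated (s ∷ W) with stepEdge G s Edges.∈? edgesW G W
  ... | yes s∈W with edgeOccurrence W s∈W
  ...   | occurrence W₁ s′ W₂ refl s′≡s = inj₂ (repeated-edge [] s W₁ s′ W₂ refl (sym s′≡s))
  edges-unique-or-repeated (s ∷ W) | no s∉W with edges-unique-or-repeated W
  ...   | inj₁ W!                                       = inj₁ (¬Any⇒All¬ _ s∉W ∷ W!)
  ...   | inj₂ (repeated-edge W₁ s₁ W₂ s₂ W₃ refl same) = inj₂ (repeated-edge (s ∷ W₁) s₁ W₂ s₂ W₃ refl same)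

  NegCircleReach : (Fin m → Set) → Fin n → Set
  NegCircleReach P u = Σ (Fin n) λ x → Σ (Walk G x x) λ D →
    IsCircle G D × walkSign G D ≡ neg × All P (edgesW G D) × Reach P u x

  neg-circle-reach-pre : ∀ {P u v} → Reach P u v → NegCircleReach P v → NegCircleReach P u
  neg-circle-reach-pre u⇝v (x , D , circle , D-neg , D⊆ , v⇝x) = x , D , circle , D-neg , D⊆ , reach-trans u⇝v v⇝x

  NegCirclesUpTo : (Fin m → Set) → ℕ → Set
  NegCirclesUpTo P f = ∀ {u} (C : Walk G u u) → len C ≤ f → walkSign G C ≡ neg → All P (edgesW G C) →
                       NegCircleReach P u

  private
    <-≤-pred : ∀ {a b f} → a < b → b ≤ suc f → a ≤ f
    <-≤-pred a<b b≤ = ℕₚ.≤-pred (ℕₚ.≤-trans a<b b≤)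

  walkSign-detour : ∀ {u x v} (W₁ : Walk G u x) (L : Walk G x x) (W₂ : Walk G x v) →
                    walkSign G (W₁ ⊕ (L ⊕ W₂)) ≡ walkSign G L *ₛ walkSign G (W₁ ⊕ W₂)
  walkSign-detour W₁ L W₂ = begin
    walkSign G (W₁ ⊕ (L ⊕ W₂))                      ≡⟨ walkSign-⊕ W₁ (L ⊕ W₂) ⟩
    walkSign G W₁ *ₛ walkSign G (L ⊕ W₂)            ≡⟨ cong (walkSign G W₁ *ₛ_) (walkSign-⊕ L W₂) ⟩
    walkSign G W₁ *ₛ (walkSign G L *ₛ walkSign G W₂) ≡⟨ x∙yz≈y∙xz (walkSign G W₁) (walkSign G L) (walkSign G W₂) ⟩
    walkSign G L *ₛ (walkSign G W₁ *ₛ walkSign G W₂) ≡⟨ cong (walkSign G L *ₛ_) (walkSign-⊕ W₁ W₂) ⟨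
    walkSign G L *ₛ walkSign G (W₁ ⊕ W₂)            ∎

  split-repeated-vertex : ∀ {P f u} {C : Walk G u u} → NegCirclesUpTo P f → RepeatedVertex C →
    len C ≤ suc f → walkSign G C ≡ neg → All P (edgesW G C) → NegCircleReach P u
  split-repeated-vertex {f = f} shorter (repeated-vertex W₁ s W₂ t W₃ refl) C≤ C-neg C⊆
    with All-⊕⁻ W₁ ((s ∷ W₂) ⊕ (t ∷ W₃)) C⊆
  ... | W₁⊆ , rest⊆ with All-⊕⁻ (s ∷ W₂) (t ∷ W₃) rest⊆
  ... | loop⊆ , W₃⊆ with neg-factor _ _ (trans (sym (walkSign-detour W₁ (s ∷ W₂) (t ∷ W₃))) C-neg)
  ...   | inj₁ loop-neg = neg-circle-reach-pre (W₁ , W₁⊆) (shorter (s ∷ W₂) loop≤ loop-neg loop⊆)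
    where
    loop≤ : len (s ∷ W₂) ≤ f
    loop≤ = <-≤-pred (ℕₚ.<-≤-trans (s≤s (len-<-⊕∷ W₂ t W₃)) (len-⊕-≤ʳ W₁ ((s ∷ W₂) ⊕ (t ∷ W₃)))) C≤
  ...   | inj₂ rest-neg = shorter (W₁ ⊕ (t ∷ W₃)) rest≤ rest-neg (All-⊕⁺ W₁ (t ∷ W₃) W₁⊆ W₃⊆)
    where
    rest≤ : len (W₁ ⊕ (t ∷ W₃)) ≤ f
    rest≤ = <-≤-pred (len-⊕-monoʳ-< W₁ (s≤s (len-⊕-≤ʳ W₂ (t ∷ W₃)))) C≤

  walkSign-repeated : ∀ {u a b a′ b′ v} (W₁ : Walk G u a) (s : Step G a b) (W₂ : Walk G b a′)
                      (s′ : Step G a′ b′) (W₃ : Walk G b′ v) → stepEdge G s ≡ stepEdge G s′ →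
                      walkSign G (W₁ ⊕ (s ∷ (W₂ ⊕ (s′ ∷ W₃)))) ≡ walkSign G W₂ *ₛ (walkSign G W₁ *ₛ walkSign G W₃)
  walkSign-repeated W₁ s W₂ s′ W₃ same = begin
    walkSign G (W₁ ⊕ (s ∷ (W₂ ⊕ (s′ ∷ W₃))))
      ≡⟨ walkSign-⊕ W₁ (s ∷ (W₂ ⊕ (s′ ∷ W₃))) ⟩
    walkSign G W₁ *ₛ (σ (stepEdge G s) *ₛ walkSign G (W₂ ⊕ (s′ ∷ W₃)))
      ≡⟨ cong (λ w → walkSign G W₁ *ₛ (σ (stepEdge G s) *ₛ w)) (walkSign-⊕ W₂ (s′ ∷ W₃)) ⟩
    walkSign G W₁ *ₛ (σ (stepEdge G s) *ₛ (walkSign G W₂ *ₛ (σ (stepEdge G s′) *ₛ walkSign G W₃)))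
      ≡⟨ cong (λ e → walkSign G W₁ *ₛ (σ (stepEdge G s) *ₛ (walkSign G W₂ *ₛ (σ e *ₛ walkSign G W₃)))) (sym same) ⟩
    walkSign G W₁ *ₛ (σ (stepEdge G s) *ₛ (walkSign G W₂ *ₛ (σ (stepEdge G s) *ₛ walkSign G W₃)))
      ≡⟨ a*[s*[b*[s*c]]]≡b*[a*c] (walkSign G W₁) (σ (stepEdge G s)) (walkSign G W₂) (walkSign G W₃) ⟩
    walkSign G W₂ *ₛ (walkSign G W₁ *ₛ walkSign G W₃) ∎

  walkSign-repeated-forward : ∀ {u a b v} (W₁ : Walk G u a) (s : Step G a b) (W₂ : Walk G b a)
                              (s′ : Step G a b) (W₃ : Walk G b v) → stepEdge G s ≡ stepEdge G s′ →
                              walkSign G (W₂ ⊕ (s′ ∷ [])) *ₛ walkSign G (W₁ ⊕ (s ∷ W₃)) ≡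
                              walkSign G (W₁ ⊕ (s ∷ (W₂ ⊕ (s′ ∷ W₃))))
  walkSign-repeated-forward W₁ s W₂ s′ W₃ same = begin
    walkSign G (W₂ ⊕ (s′ ∷ [])) *ₛ walkSign G (W₁ ⊕ (s ∷ W₃))
      ≡⟨ cong₂ _*ₛ_ (walkSign-⊕ W₂ (s′ ∷ [])) (walkSign-⊕ W₁ (s ∷ W₃)) ⟩
    (walkSign G W₂ *ₛ (σ (stepEdge G s′) *ₛ pos)) *ₛ (walkSign G W₁ *ₛ (σ (stepEdge G s) *ₛ walkSign G W₃))
      ≡⟨ cong (λ e → (walkSign G W₂ *ₛ (σ e *ₛ pos)) *ₛ _) (sym same) ⟩
    (walkSign G W₂ *ₛ (σ (stepEdge G s) *ₛ pos)) *ₛ (walkSign G W₁ *ₛ (σ (stepEdge G s) *ₛ walkSign G W₃))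
      ≡⟨ [b*[s*+]]*[a*[s*c]]≡b*[a*c] (walkSign G W₁) (σ (stepEdge G s)) (walkSign G W₂) (walkSign G W₃) ⟩
    walkSign G W₂ *ₛ (walkSign G W₁ *ₛ walkSign G W₃)
      ≡⟨ walkSign-repeated W₁ s W₂ s′ W₃ same ⟨
    walkSign G (W₁ ⊕ (s ∷ (W₂ ⊕ (s′ ∷ W₃)))) ∎

  -- The two traversals of the repeated edge contribute σ(e)² = + to the sign,
  -- so it is the product of the signs of the two closed pieces.
  split-repeated-edge : ∀ {P f u} {C : Walk G u u} → NegCirclesUpTo P f → RepeatedEdge C →
    len C ≤ suc f → walkSign G C ≡ neg → All P (edgesW G C) → NegCircleReach P u
  split-repeated-edge {f = f} shorter (repeated-edge W₁ s W₂ s′ W₃ refl same) C≤ C-neg C⊆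
    with All-⊕⁻ W₁ (s ∷ (W₂ ⊕ (s′ ∷ W₃))) C⊆
  ... | W₁⊆ , (s∈ ∷ rest⊆) with All-⊕⁻ W₂ (s′ ∷ W₃) rest⊆
  ... | W₂⊆ , (s′∈ ∷ W₃⊆) with same-edge-steps s s′ same
  ... | inj₁ (refl , refl) with neg-factor _ _ (trans (walkSign-repeated-forward W₁ s W₂ s′ W₃ same) C-neg)
  ...   | inj₁ loop-neg = neg-circle-reach-pre (W₁ ⊕ (s ∷ []) , All-⊕⁺ W₁ (s ∷ []) W₁⊆ (s∈ ∷ []))
                            (shorter (W₂ ⊕ (s′ ∷ [])) loop≤ loop-neg (All-⊕⁺ W₂ (s′ ∷ []) W₂⊆ (s′∈ ∷ [])))
    where
    loop≤ : len (W₂ ⊕ (s′ ∷ [])) ≤ f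
    loop≤ = <-≤-pred (ℕₚ.<-≤-trans (s≤s (len-⊕-monoʳ-≤ W₂ (s≤s z≤n))) (len-⊕-≤ʳ W₁ (s ∷ (W₂ ⊕ (s′ ∷ W₃))))) C≤
  ...   | inj₂ rest-neg = shorter (W₁ ⊕ (s ∷ W₃)) rest≤ rest-neg (All-⊕⁺ W₁ (s ∷ W₃) W₁⊆ (s∈ ∷ W₃⊆))
    where
    rest≤ : len (W₁ ⊕ (s ∷ W₃)) ≤ f
    rest≤ = <-≤-pred (len-⊕-monoʳ-< W₁ (s≤s (len-⊕-≤ʳ W₂ (s′ ∷ W₃)))) C≤
  split-repeated-edge {f = f} shorter (repeated-edge W₁ s W₂ s′ W₃ refl same) C≤ C-neg C⊆
    | W₁⊆ , (s∈ ∷ _) | W₂⊆ , (_ ∷ W₃⊆) | inj₂ (refl , refl)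
    with neg-factor _ _ (trans (sym (walkSign-repeated W₁ s W₂ s′ W₃ same)) C-neg)
  ... | inj₁ loop-neg = neg-circle-reach-pre (W₁ ⊕ (s ∷ []) , All-⊕⁺ W₁ (s ∷ []) W₁⊆ (s∈ ∷ []))
                          (shorter W₂ loop≤ loop-neg W₂⊆)
    where
    loop≤ : len W₂ ≤ f
    loop≤ = <-≤-pred (ℕₚ.<-≤-trans (ℕₚ.m<n⇒m<1+n (len-<-⊕∷ W₂ s′ W₃)) (len-⊕-≤ʳ W₁ (s ∷ (W₂ ⊕ (s′ ∷ W₃))))) C≤
  ... | inj₂ rest-neg = shorter (W₁ ⊕ W₃) rest≤ (trans (walkSign-⊕ W₁ W₃) rest-neg) (All-⊕⁺ W₁ W₃ W₁⊆ W₃⊆)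
    where
    rest≤ : len (W₁ ⊕ W₃) ≤ f
    rest≤ = <-≤-pred (len-⊕-monoʳ-< W₁ (ℕₚ.m<n⇒m<1+n (len-⊕-≤ʳ W₂ (s′ ∷ W₃)))) C≤

  negCircle-fuel : ∀ {P} f → NegCirclesUpTo P f
  negCircle-fuel zero    []      _  ()    _
  negCircle-fuel zero    (_ ∷ _) ()
  negCircle-fuel (suc f) C C≤ C-neg C⊆ with vertices-unique-or-repeated C
  ... | inj₂ repeated = split-repeated-vertex (negCircle-fuel f) repeated C≤ C-neg C⊆
  ... | inj₁ verts! with edges-unique-or-repeated C
  ...   | inj₂ repeated = split-repeated-edge (negCircle-fuel f) repeated C≤ C-neg C⊆
  negCircle-fuel (suc f) []      _ () _ | inj₁ _ | inj₁ _
  negCircle-fuel (suc f) {u} (s ∷ C) _ C-neg C⊆ | inj₁ verts! | inj₁ edges! =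
    u , s ∷ C , (verts! , edges!) , C-neg , C⊆ , reach-refl

  negCircle : ∀ {P u} (C : Walk G u u) → walkSign G C ≡ neg → All P (edgesW G C) → NegCircleReach P u
  negCircle C = negCircle-fuel (len C) C ℕₚ.≤-refl

  module _ (S : Subset m) where
    open Components (components-of S)

    balanced⇒BalancedAt : ∀ x → IsBalanced x → BalancedAt G S x
    balanced⇒BalancedAt x bx =
      (λ u h kh h∈S x⇝u → no-half h u h∈S kh (reached x⇝u)) ,
      (λ u C _ C-neg C⊆S x⇝u → pos≢neg (trans (sym (closed-walk-positive C C⊆S (reached x⇝u))) C-neg))
      where
      reached : ∀ {u} → Reach (_∈ S) x u → IsBalanced u
      reached (W , W⊆S) = balanced-resp (label-walk W W⊆S) bx

    BalancedAt⇒balanced : ∀ x → BalancedAt G S x → IsBalanced x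
    BalancedAt⇒balanced x (no-half-edge , no-neg-circle) with T? (balancedLabel (label x))
    ... | yes bx = bx
    ... | no ¬bx with unbalancing x ¬bx
    ...   | inj₁ (u , h , kh , h∈S , x⇝u) = ⊥-elim (no-half-edge u h kh h∈S x⇝u)
    ...   | inj₂ (u , C , C-neg , C⊆S , x⇝u) with negCircle C C-neg C⊆S
    ...     | y , D , circle , D-neg , D⊆S , u⇝y = ⊥-elim (no-neg-circle y D circle D-neg D⊆S (reach-trans x⇝u u⇝y))

  bΣ-exists : ∀ S → Σ ℕ (BΣ G S)
  bΣ-exists S =
    b , k , index , surjective ,
    (λ v w → label-reach v w ∘ index⇒f v w , f⇒index v w ∘ λ (W , W⊆S) → label-walk W W⊆S) ,
    (λ v → balanced⇒BalancedAt S v ∘ <b⇒Q v , Q⇒<b v ∘ BalancedAt⇒balanced S v) ,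
    b≤k
    where
    open Components (components-of S)
    open DenseIndexing (denseIndexing label (T? ∘ balancedLabel))

  -- Each sign-balanced component of S′ lies in a distinct sign-balanced component of S.
  BΣ-≤ : ∀ {S S′ b b′} → BΣ G S b → BΣ G S′ b′ →
    (∀ v → BalancedAt G S′ v → BalancedAt G S v) →
    (∀ v w → BalancedAt G S′ v → Conn G S v w → Conn G S′ v w) → b′ ≤ b
  BΣ-≤ {b′ = b′} (_ , c , _ , c-conn , c-bal , _) (_ , c′ , c′-onto , c′-conn , c′-bal , b′≤k′) bal⇒ conn⇒ =
    Finₚ.injective⇒≤ F-injective
    where
    rep : Fin b′ → Fin n
    rep i = proj₁ (c′-onto (inject≤ i b′≤k′))
    rep-index : ∀ i → c′ (rep i) ≡ inject≤ i b′≤k′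
    rep-index i = proj₂ (c′-onto (inject≤ i b′≤k′))
    rep-balanced : ∀ i → BalancedAt G _ (rep i)
    rep-balanced i = proj₁ (c′-bal (rep i))
      (subst (_< b′) (sym (trans (cong toℕ (rep-index i)) (Finₚ.toℕ-inject≤ i b′≤k′))) (Finₚ.toℕ<n i))
    F : Fin b′ → Fin _
    F i = fromℕ< (proj₂ (c-bal (rep i)) (bal⇒ (rep i) (rep-balanced i)))
    F-injective : ∀ {i j} → F i ≡ F j → i ≡ j
    F-injective {i} {j} Fi≡Fj = Finₚ.inject≤-injective b′≤k′ b′≤k′ i j (begin
      inject≤ i b′≤k′ ≡⟨ rep-index i ⟨
      c′ (rep i)      ≡⟨ proj₂ (c′-conn (rep i) (rep j)) (conn⇒ (rep i) (rep j) (rep-balanced i) (proj₁ (c-conn (rep i) (rep j)) same-c)) ⟩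
      c′ (rep j)      ≡⟨ rep-index j ⟩
      inject≤ j b′≤k′ ∎)
      where
      same-c : c (rep i) ≡ c (rep j)
      same-c = Finₚ.toℕ-injective (trans (sym (Finₚ.toℕ-fromℕ< _)) (trans (cong toℕ Fi≡Fj) (Finₚ.toℕ-fromℕ< _)))

  BalancedAt-antitone : ∀ {S S′} → S ⊆ S′ → ∀ v → BalancedAt G S′ v → BalancedAt G S v
  BalancedAt-antitone S⊆S′ v (no-half-edge , no-neg-circle) =
    (λ u h kh h∈S v⇝u → no-half-edge u h kh (S⊆S′ h∈S) (reach-map S⊆S′ v⇝u)) ,
    (λ u C circle C-neg C⊆S v⇝u → no-neg-circle u C circle C-neg (All.map S⊆S′ C⊆S) (reach-map S⊆S′ v⇝u))

  BΣ-antitone : ∀ {S S′ b b′} → S ⊆ S′ → BΣ G S b → BΣ G S′ b′ → b′ ≤ b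
  BΣ-antitone S⊆S′ bΣ bΣ′ = BΣ-≤ bΣ bΣ′ (BalancedAt-antitone S⊆S′) (λ _ _ _ → reach-map S⊆S′)

  -- B is the (sign-balanced) component of v in A.
  module Closure {A : Subset m} (maximal : MaximalHyperbalanced G A) {v : Fin n}
                 (v-balanced : Components.IsBalanced (components-of A) v) where
    open Components (components-of A)

    InB : Fin n → Set
    InB x = label x ≡ label v

    InB-balanced : ∀ {x} → InB x → IsBalanced x
    InB-balanced x∈B = balanced-resp (sym x∈B) v-balanced

    InB-walk : ∀ {x y} (W : Walk G x y) → All (_∈ A) (edgesW G W) → InB x → InB y
    InB-walk W W⊆A x∈B = trans (sym (label-walk W W⊆A)) x∈B

    InB-walk⁻ : ∀ {x y} (W : Walk G x y) → All (_∈ A) (edgesW G W) → InB y → InB x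
    InB-walk⁻ W W⊆A y∈B = trans (label-walk W W⊆A) y∈B

    both-in-B : ∀ {p q} → label p ≡ label q → InB p ⊎ InB q → InB p × InB q
    both-in-B p∼q (inj₁ p∈B) = p∈B , trans (sym p∼q) p∈B
    both-in-B p∼q (inj₂ q∈B) = trans p∼q q∈B , q∈B

    no-negative-walk : ∀ {x} (C : Walk G x x) → All (_∈ A) (edgesW G C) → InB x → walkSign G C ≢ neg
    no-negative-walk C C⊆A x∈B C-neg = pos≢neg (trans (sym (closed-walk-positive C C⊆A (InB-balanced x∈B))) C-neg)

    no-half-edge : ∀ {h x} → h ∈ A → kind h ≡ half x → ¬ InB x
    no-half-edge {h} {x} h∈A kh x∈B = no-half h x h∈A kh (InB-balanced x∈B)

    NoCircuitThrough : Fin m → Set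
    NoCircuitThrough e = (C : SignCircuit G) → All (_∈ A ∪ ⁅ e ⁆) (circEdges G C) → e ∉ₗ circEdges G C

    new-edge-on-circuit : ∀ {e} → e ∉ A → ¬ NoCircuitThrough e
    new-edge-on-circuit {e} e∉A none = proj₂ maximal (A ∪ ⁅ e ⁆) (p⊂p∪⁅e⁆ e∉A) hyperbalanced
      where
      hyperbalanced : Hyperbalanced G (A ∪ ⁅ e ⁆)
      hyperbalanced C C⊆ with e Edges.∈? circEdges G C
      ... | yes e∈C = contradiction e∈C (none C C⊆)
      ... | no e∉C  = proj₁ maximal C (All-∈-∪⁅⁆⁻ C⊆ e∉C)

    half∈A : ∀ {e p q h u} → kind e ≡ edge2 p q → kind h ≡ half u → h ∈ A ∪ ⁅ e ⁆ → h ∈ A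
    half∈A ke kh h∈ = ∈-∪⁅⁆⁻ h∈ λ { refl → edge2≢half (trans (sym ke) kh) }

    record SplitAt (e : Fin m) {x y : Fin n} (W : Walk G x y) : Set where
      constructor splitAt
      field
        {a b}     : Fin n
        before    : Walk G x a
        step      : Step G a b
        after     : Walk G b y
        step-edge : stepEdge G step ≡ e
        before⊆A  : All (_∈ A) (edgesW G before)
        after⊆A   : All (_∈ A) (edgesW G after)
        sign      : walkSign G W ≡ walkSign G before *ₛ (σ e *ₛ walkSign G after)

    splitAt-unique : ∀ {e x y} (W : Walk G x y) → All (_∈ A ∪ ⁅ e ⁆) (edgesW G W) → Unique (edgesW G W) →
                     e ∈ₗ edgesW G W → SplitAt e W
    splitAt-unique W W⊆ W! e∈W with edgeOccurrence W e∈W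
    ... | occurrence W₁ s W₂ refl refl
      with All-⊕⁻ W₁ (s ∷ W₂) W⊆ | Unique-++⁻ (edgesW G W₁) _ (subst Unique (edgesW-⊕ W₁ (s ∷ W₂)) W!)
    ... | W₁⊆ , (_ ∷ W₂⊆) | _ , (e∉W₂ ∷ _) , W₁#W₂ =
      splitAt W₁ s W₂ refl (All-∈-∪⁅⁆⁻ W₁⊆ (λ e∈W₁ → W₁#W₂ (e∈W₁ , here refl)))
                           (All-∈-∪⁅⁆⁻ W₂⊆ (λ e∈W₂ → All.lookup e∉W₂ e∈W₂ refl)) (walkSign-⊕ W₁ (s ∷ W₂))

    -- What rules out sign circuits through e: walks using e once have an end
    -- in B, and closed ones are moreover negative.
    record Crossing (e : Fin m) : Set where
      field
        closed-in-B : ∀ {x} (C : Walk G x x) → All (_∈ A ∪ ⁅ e ⁆) (edgesW G C) → Unique (edgesW G C) →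
                      e ∈ₗ edgesW G C → InB x × walkSign G C ≡ neg
        end-in-B    : ∀ {x y} (W : Walk G x y) → All (_∈ A ∪ ⁅ e ⁆) (edgesW G W) → Unique (edgesW G W) →
                      e ∈ₗ edgesW G W → InB x ⊎ InB y

    split-labels : ∀ {e p q x y} {W : Walk G x y} → kind e ≡ edge2 p q → SplitAt e W →
                   (label x ≡ label p × label y ≡ label q) ⊎ (label x ≡ label q × label y ≡ label p)
    split-labels ke (splitAt W₁ s W₂ s-e W₁⊆ W₂⊆ _) with step-ends ke s s-e
    ... | inj₁ (refl , refl) = inj₁ (label-walk W₁ W₁⊆ , sym (label-walk W₂ W₂⊆))
    ... | inj₂ (refl , refl) = inj₂ (label-walk W₁ W₁⊆ , sym (label-walk W₂ W₂⊆))

    bridge-crossing : ∀ {e p q} → kind e ≡ edge2 p q → label p ≢ label q → InB p ⊎ InB q → Crossing e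
    bridge-crossing {e} {p} {q} ke apart p∨q = record { closed-in-B = closed ; end-in-B = ends }
      where
      closed : ∀ {x} (C : Walk G x x) → All (_∈ A ∪ ⁅ e ⁆) (edgesW G C) → Unique (edgesW G C) →
               e ∈ₗ edgesW G C → InB x × walkSign G C ≡ neg
      closed C C⊆ C! e∈C with split-labels ke (splitAt-unique C C⊆ C! e∈C)
      ... | inj₁ (x∼p , x∼q) = contradiction (trans (sym x∼p) x∼q) apart
      ... | inj₂ (x∼q , x∼p) = contradiction (trans (sym x∼p) x∼q) apart
      ends : ∀ {x y} (W : Walk G x y) → All (_∈ A ∪ ⁅ e ⁆) (edgesW G W) → Unique (edgesW G W) →
             e ∈ₗ edgesW G W → InB x ⊎ InB y
      ends {x} {y} W W⊆ W! e∈W = pick (split-labels ke (splitAt-unique W W⊆ W! e∈W)) p∨q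
        where
        pick : (label x ≡ label p × label y ≡ label q) ⊎ (label x ≡ label q × label y ≡ label p) →
               InB p ⊎ InB q → InB x ⊎ InB y
        pick (inj₁ (x∼p , _)) (inj₁ p∈B) = inj₁ (trans x∼p p∈B)
        pick (inj₁ (_ , y∼q)) (inj₂ q∈B) = inj₂ (trans y∼q q∈B)
        pick (inj₂ (_ , y∼p)) (inj₁ p∈B) = inj₂ (trans y∼p p∈B)
        pick (inj₂ (x∼q , _)) (inj₂ q∈B) = inj₁ (trans x∼q q∈B)

    step-in-B : ∀ {e p q a b} → kind e ≡ edge2 p q → InB p → InB q → ζ p *ₛ ζ q ≢ σ e →
                (s : Step G a b) → stepEdge G s ≡ e → InB a × InB b × σ e ≢ ζ a *ₛ ζ b
    step-in-B {p = p} {q} ke p∈B q∈B inconsistent s s-e with step-ends ke s s-e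
    ... | inj₁ (refl , refl) = p∈B , q∈B , inconsistent ∘ sym
    ... | inj₂ (refl , refl) = q∈B , p∈B , λ eq → inconsistent (trans (Signₚ.*-comm (ζ p) (ζ q)) (sym eq))

    inconsistent-crossing : ∀ {e p q} → kind e ≡ edge2 p q → InB p → InB q → ζ p *ₛ ζ q ≢ σ e → Crossing e
    inconsistent-crossing {e} ke p∈B q∈B inconsistent = record { closed-in-B = closed ; end-in-B = ends }
      where
      closed : ∀ {x} (C : Walk G x x) → All (_∈ A ∪ ⁅ e ⁆) (edgesW G C) → Unique (edgesW G C) →
               e ∈ₗ edgesW G C → InB x × walkSign G C ≡ neg
      closed {x} C C⊆ C! e∈C with splitAt-unique C C⊆ C! e∈C
      ... | splitAt {a} {b} W₁ s W₂ s-e W₁⊆ W₂⊆ C-sign with step-in-B ke p∈B q∈B inconsistent s s-e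
      ...   | a∈B , b∈B , σ≢ = x∈B , (begin
        walkSign G C                              ≡⟨ C-sign ⟩
        walkSign G W₁ *ₛ (σ e *ₛ walkSign G W₂)   ≡⟨ cong₂ (λ w w′ → w *ₛ (σ e *ₛ w′)) (ζ-walk W₁ W₁⊆ (InB-balanced x∈B))
                                                                                        (ζ-walk W₂ W₂⊆ (InB-balanced b∈B)) ⟩
        (ζ x *ₛ ζ a) *ₛ (σ e *ₛ (ζ b *ₛ ζ x))     ≡⟨ [x*a]*[s*[b*x]]≡s*[a*b] (ζ x) (ζ a) (σ e) (ζ b) ⟩
        σ e *ₛ (ζ a *ₛ ζ b)                       ≡⟨ ≢⇒*ₛ≡neg σ≢ ⟩
        neg                                       ∎)
        where
        x∈B : InB x
        x∈B = InB-walk⁻ W₁ W₁⊆ a∈B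
      ends : ∀ {x y} (W : Walk G x y) → All (_∈ A ∪ ⁅ e ⁆) (edgesW G W) → Unique (edgesW G W) →
             e ∈ₗ edgesW G W → InB x ⊎ InB y
      ends W W⊆ W! e∈W with splitAt-unique W W⊆ W! e∈W
      ... | splitAt W₁ s _ s-e W₁⊆ _ _ = inj₁ (InB-walk⁻ W₁ W₁⊆ (proj₁ (step-in-B ke p∈B q∈B inconsistent s s-e)))

    crossing⇒no-circuit : ∀ {e p q} → kind e ≡ edge2 p q → Crossing e → NoCircuitThrough e
    crossing⇒no-circuit ke X (looseE _ kl) _ (here refl) = loose≢edge2 (trans (sym kl) ke)
    crossing⇒no-circuit ke X (posCircle C circle C-pos) C⊆ e∈C =
      pos≢neg (trans (sym C-pos) (proj₂ (Crossing.closed-in-B X C C⊆ (circle-unique C circle) e∈C)))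
    crossing⇒no-circuit ke X (hcCC C₁ P C₂ circle₁ circle₂ path C₁-neg C₂-neg C! _ _ _) C⊆ e∈C
      with All-++⁻ (edgesW G C₁) C⊆
    ... | C₁⊆ , rest⊆ with All-++⁻ (edgesW G P) rest⊆
    ... | P⊆ , C₂⊆ with occurrence-++₃ (edgesW G C₁) (edgesW G P) (edgesW G C₂) C! e∈C
    ...   | inj₁ (e∈C₁ , e∉P , e∉C₂) =
      no-negative-walk C₂ (All-∈-∪⁅⁆⁻ C₂⊆ e∉C₂)
        (InB-walk P (All-∈-∪⁅⁆⁻ P⊆ e∉P) (proj₁ (Crossing.closed-in-B X C₁ C₁⊆ (circle-unique C₁ circle₁) e∈C₁))) C₂-neg
    ...   | inj₂ (inj₁ (e∉C₁ , e∈P , e∉C₂)) =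
      [ (λ u∈B → no-negative-walk C₁ (All-∈-∪⁅⁆⁻ C₁⊆ e∉C₁) u∈B C₁-neg)
      , (λ w∈B → no-negative-walk C₂ (All-∈-∪⁅⁆⁻ C₂⊆ e∉C₂) w∈B C₂-neg)
      ] (Crossing.end-in-B X P P⊆ (path-unique P path) e∈P)
    ...   | inj₂ (inj₂ (e∉C₁ , e∉P , e∈C₂)) =
      no-negative-walk C₁ (All-∈-∪⁅⁆⁻ C₁⊆ e∉C₁)
        (InB-walk⁻ P (All-∈-∪⁅⁆⁻ P⊆ e∉P) (proj₁ (Crossing.closed-in-B X C₂ C₂⊆ (circle-unique C₂ circle₂) e∈C₂))) C₁-neg
    crossing⇒no-circuit ke X (hcHC h kh P C₂ path circle₂ C₂-neg PC! _) (h∈ ∷ PC⊆) (here refl) =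
      edge2≢half (trans (sym ke) kh)
    crossing⇒no-circuit ke X (hcHC h kh P C₂ path circle₂ C₂-neg PC! _) (h∈ ∷ PC⊆) (there e∈PC)
      with All-++⁻ (edgesW G P) PC⊆ | occurrence-++ (edgesW G P) (edgesW G C₂) PC! e∈PC
    ... | P⊆ , C₂⊆ | inj₁ (e∈P , e∉C₂) =
      [ no-half-edge (half∈A ke kh h∈) kh
      , (λ w∈B → no-negative-walk C₂ (All-∈-∪⁅⁆⁻ C₂⊆ e∉C₂) w∈B C₂-neg)
      ] (Crossing.end-in-B X P P⊆ (path-unique P path) e∈P)
    ... | P⊆ , C₂⊆ | inj₂ (e∉P , e∈C₂) =
      no-half-edge (half∈A ke kh h∈) kh
        (InB-walk⁻ P (All-∈-∪⁅⁆⁻ P⊆ e∉P) (proj₁ (Crossing.closed-in-B X C₂ C₂⊆ (circle-unique C₂ circle₂) e∈C₂)))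
    crossing⇒no-circuit ke X (hcHH h₁ h₂ k₁ k₂ _ P path) _ (here refl)         = edge2≢half (trans (sym ke) k₁)
    crossing⇒no-circuit ke X (hcHH h₁ h₂ k₁ k₂ _ P path) _ (there (here refl)) = edge2≢half (trans (sym ke) k₂)
    crossing⇒no-circuit ke X (hcHH h₁ h₂ k₁ k₂ _ P path) (h₁∈ ∷ h₂∈ ∷ P⊆) (there (there e∈P)) =
      [ no-half-edge (half∈A ke k₁ h₁∈) k₁ , no-half-edge (half∈A ke k₂ h₂∈) k₂ ]
        (Crossing.end-in-B X P P⊆ (path-unique P path) e∈P)

    half-at-B⇒no-circuit : ∀ {e a} → kind e ≡ half a → InB a → NoCircuitThrough e
    half-at-B⇒no-circuit ke a∈B (looseE _ kl) _ (here refl) = loose≢half (trans (sym kl) ke)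
    half-at-B⇒no-circuit ke a∈B (posCircle C _ _) _ e∈C = half∉walk C ke e∈C
    half-at-B⇒no-circuit ke a∈B (hcCC C₁ P C₂ _ _ _ _ _ _ _ _ _) _ e∈C =
      [ half∉walk C₁ ke , [ half∉walk P ke , half∉walk C₂ ke ] ∘ ∈-++⁻ (edgesW G P) ] (∈-++⁻ (edgesW G C₁) e∈C)
    half-at-B⇒no-circuit ke a∈B (hcHC h kh P C₂ _ _ C₂-neg _ _) (_ ∷ PC⊆) (here refl)
      with half-injective (trans (sym kh) ke) | All-++⁻ (edgesW G P) PC⊆
    ... | refl | P⊆ , C₂⊆ =
      no-negative-walk C₂ (All-∈-∪⁅⁆⁻ C₂⊆ (half∉walk C₂ ke)) (InB-walk P (All-∈-∪⁅⁆⁻ P⊆ (half∉walk P ke)) a∈B) C₂-neg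
    half-at-B⇒no-circuit ke a∈B (hcHC h kh P C₂ _ _ _ _ _) _ (there e∈PC) =
      [ half∉walk P ke , half∉walk C₂ ke ] (∈-++⁻ (edgesW G P) e∈PC)
    half-at-B⇒no-circuit ke a∈B (hcHH h₁ h₂ k₁ k₂ h₁≢h₂ P _) (_ ∷ h₂∈ ∷ P⊆) (here refl)
      with half-injective (trans (sym k₁) ke)
    ... | refl = no-half-edge (∈-∪⁅⁆⁻ h₂∈ (h₁≢h₂ ∘ sym)) k₂ (InB-walk P (All-∈-∪⁅⁆⁻ P⊆ (half∉walk P ke)) a∈B)
    half-at-B⇒no-circuit ke a∈B (hcHH h₁ h₂ k₁ k₂ h₁≢h₂ P _) (h₁∈ ∷ _ ∷ P⊆) (there (here refl))
      with half-injective (trans (sym k₂) ke)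
    ... | refl = no-half-edge (∈-∪⁅⁆⁻ h₁∈ h₁≢h₂) k₁ (InB-walk⁻ P (All-∈-∪⁅⁆⁻ P⊆ (half∉walk P ke)) a∈B)
    half-at-B⇒no-circuit ke a∈B (hcHH _ _ _ _ _ P _) _ (there (there e∈P)) = half∉walk P ke e∈P

    edge-at-B : ∀ e {p q} → kind e ≡ edge2 p q → InB p ⊎ InB q → InB p × InB q × ζ p *ₛ ζ q ≡ σ e
    edge-at-B e {p} {q} ke p∨q with e ∈? A
    ... | yes e∈A = let (p∈B , q∈B) = both-in-B (label-edge e p q e∈A ke) p∨q in
                    p∈B , q∈B , ζ-edge e p q e∈A ke (InB-balanced p∈B)
    ... | no e∉A with label p Finₚ.≟ label q
    ...   | no apart = ⊥-elim (new-edge-on-circuit e∉A (crossing⇒no-circuit ke (bridge-crossing ke apart p∨q)))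
    ...   | yes p∼q with both-in-B p∼q p∨q | ζ p *ₛ ζ q Signₚ.≟ σ e
    ...     | p∈B , q∈B | yes consistent = p∈B , q∈B , consistent
    ...     | p∈B , q∈B | no inconsistent =
      ⊥-elim (new-edge-on-circuit e∉A (crossing⇒no-circuit ke (inconsistent-crossing ke p∈B q∈B inconsistent)))

    no-half-at-B : ∀ h {a} → kind h ≡ half a → ¬ InB a
    no-half-at-B h kh a∈B with h ∈? A
    ... | yes h∈A = no-half-edge h∈A kh a∈B
    ... | no h∉A  = new-edge-on-circuit h∉A (half-at-B⇒no-circuit kh a∈B)

    step-from-B : ∀ {x y} (s : Step G x y) → InB x → InB y × σ (stepEdge G s) ≡ ζ x *ₛ ζ y
    step-from-B {x} {y} s x∈B with step-kind s
    ... | inj₁ k = let (_ , y∈B , consistent) = edge-at-B _ k (inj₁ x∈B) in y∈B , sym consistent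
    ... | inj₂ k = let (y∈B , _ , consistent) = edge-at-B _ k (inj₂ x∈B) in
                   y∈B , trans (sym consistent) (Signₚ.*-comm (ζ y) (ζ x))

    walk-from-B : ∀ {x y} (W : Walk G x y) → InB x → InB y × walkSign G W ≡ ζ x *ₛ ζ y
    walk-from-B {x} []      x∈B = x∈B , sym (Signₚ.s*s≡+ (ζ x))
    walk-from-B {x} {y} (_∷_ {v = z} s W) x∈B =
      let (z∈B , σ≡) = step-from-B s x∈B
          (y∈B , W≡) = walk-from-B W z∈B
      in y∈B , trans (cong₂ _*ₛ_ σ≡ W≡) ([a*b]*[b*c]≡a*c (ζ x) (ζ z) (ζ y))

    balanced-in-E : BalancedAt G ⊤ v
    balanced-in-E =
      (λ u h kh _ (W , _) → no-half-at-B h kh (proj₁ (walk-from-B W refl))) ,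
      (λ u C _ C-neg _ (W , _) → let u∈B = proj₁ (walk-from-B W refl) in
        pos≢neg (trans (sym (trans (proj₂ (walk-from-B C u∈B)) (Signₚ.s*s≡+ (ζ u)))) C-neg))

    reach-in-A : ∀ w → Conn G ⊤ v w → Conn G A v w
    reach-in-A w (W , _) = label-reach v w (sym (proj₁ (walk-from-B W refl)))

  maximal⇒bΣ : ∀ {A b} → MaximalHyperbalanced G A → BΣ G ⊤ b → BΣ G A b
  maximal⇒bΣ {A} {b} maximal bΣE = subst (BΣ G A) (ℕₚ.≤-antisym bA≤b b≤bA) bΣA
    where
    bΣA : BΣ G A (proj₁ (bΣ-exists A))
    bΣA = proj₂ (bΣ-exists A)
    b≤bA : b ≤ proj₁ (bΣ-exists A)
    b≤bA = BΣ-antitone (λ _ → ∈⊤) bΣA bΣE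
    bA≤b : proj₁ (bΣ-exists A) ≤ b
    bA≤b = BΣ-≤ bΣE bΣA
      (λ v v-bal → Closure.balanced-in-E maximal (BalancedAt⇒balanced A v v-bal))
      (λ v w v-bal → Closure.reach-in-A maximal (BalancedAt⇒balanced A v v-bal) w)

  maximal⇒flat : ∀ {A} → MaximalHyperbalanced G A → IsFlat G A
  maximal⇒flat (hyperbalanced , _) _ _ _ _ (_ , _ , inj₂ (frustrated , _)) _ = contradiction hyperbalanced frustrated
  maximal⇒flat (_ , maximal) e e∉A _ _ (_ , _ , inj₁ _) (_ , _ , inj₁ (hyperbalanced′ , _)) =
    contradiction hyperbalanced′ (maximal _ (p⊂p∪⁅e⁆ e∉A))
  maximal⇒flat _ e _ _ _ (_ , bΣ , inj₁ (_ , refl)) (_ , bΣ′ , inj₂ (_ , refl)) =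
    s≤s (ℕₚ.∸-monoʳ-≤ n (BΣ-antitone (p⊆p∪q ⁅ e ⁆) bΣ bΣ′))

lemma6p2 : ∀ {c ℓ : Level} {K : Field c ℓ} → CharNot2 K → {n m : ℕ} (G : GSG K n m) →
    ¬ Hyperbalanced G ⊤ →
    (A : Subset m) → MaximalHyperbalanced G A →
    IsCoatom G A ×
    (Σ ℕ λ bE → BΣ G ⊤ bE × BΣ G A bE × Rank G A (n ∸ bE) × Rank G ⊤ (suc (n ∸ bE)))
lemma6p2 _ {n} G frustrated A maximal@(hyperbalanced , _) =
  (maximal⇒flat G maximal , n ∸ bE , rankE , rankA) , bE , bΣE , bΣA , rankA , rankE
  where
  bE : ℕ
  bE = proj₁ (bΣ-exists G ⊤)
  bΣE : BΣ G ⊤ bE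
  bΣE = proj₂ (bΣ-exists G ⊤)
  bΣA : BΣ G A bE
  bΣA = maximal⇒bΣ G maximal bΣE
  rankA : Rank G A (n ∸ bE)
  rankA = bE , bΣA , inj₁ (hyperbalanced , refl)
  rankE : Rank G ⊤ (suc (n ∸ bE))
  rankE = bE , bΣE , inj₂ (frustrated , refl)
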